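{- Let $p$ be a depth-zero pattern of dimensions $a\times c$, and let $o_1,\dots,o_m$ ($m\ge 0$) be all the distinct bifixes of $p$. For each $j$, write $p=p_j''o_j$ and let $b_j\times d_j$ be the dimensions of $p_j''$. Let $s_n(x)$ denote the number of ballot paths from $(0,0)$ to $(n,x)$ avoiding $p$ (for integers $n\ge 0$, $x\ge n$), with the conventions $s_n(n-1)=0$ for $n\ge 1$ and $s_j(y)=0$ for $j<0$. Then for all $n\ge 1$ and $x\ge n$, $$s_n(x)=s_{n-1}(x)+s_n(x-1)-\sum_{k\ge 0}(-1)^k\sum_{i_1+\cdots+i_m=k}\binom{k}{i_1,\ldots,i_m}\, s_{\,n-a-\sum_j i_jb_j}\Big(x-c-\sum_j i_jd_j\Big),$$ where the inner sum runs over nonnegative integers $i_1,\dots,i_m$ (when $m=0$ only the term $k=0$, namely $s_{n-a}(x-c)$, occurs).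
   Context: Paths are words over $\{u,r\}$, $u$ = up step $(0,1)$, $r$ = right step $(1,0)$. A ballot path is a path starting at the origin that stays weakly above the line $y=x$ (every prefix has at least as many $u$'s as $r$'s). A pattern is a finite nonempty word $p$ over $\{u,r\}$; a path avoids $p$ if $p$ does not occur in it as a contiguous subword. If $p$ has $a$ letters $r$ and $c$ letters $u$, then $p$ has dimensions $a\times c$. A nonempty word $o$ is a bifix of $p$ if $p=op'$ and $p=p''o$ for some nonempty words $p',p''$. The reverse $\tilde p$ of $p$ is obtained by reading $p$ backwards and interchanging $u$ and $r$; $p$ is depth-zero if $\tilde p$ is a ballot path (equivalently, every suffix of $p$ has at least as many $r$'s as $u$'s). $\binom{k}{i_1,\ldots,i_m}=k!/(i_1!\cdots i_m!)$ is the multinomial coefficient. -}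

module Defs where

open import Data.Nat as ℕ using (ℕ; zero; suc; _≤_; _≤?_; _∸_; NonZero)
open import Data.Nat.Properties using (_!≢0; m*n≢0)
open import Data.Nat.Combinatorics using ()
open import Data.Nat.Base using (_!)
open import Data.Integer as ℤ using (ℤ; +_; -[1+_]; -1ℤ; 0ℤ)
open import Data.List using (List; []; _∷_; _++_; length; reverse; map; filter; inits; take; concatMap; upTo)
open import Data.Nat.ListAction using (product)
open import Data.List.Relation.Unary.All using (All; all?)
open import Data.List.Relation.Binary.Infix.Heterogeneous using (Infix)
open import Data.List.Relation.Binary.Infix.Heterogeneous.Properties using (infix?)
open import Data.Product using (Σ; ∃; ∃-syntax; _×_; _,_)
open import Relation.Binary.PropositionalEquality using (_≡_; _≢_; refl)
open import Relation.Nullary using (Dec; yes; no; ¬_; ¬?)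
open import Relation.Nullary.Decidable using (_×-dec_)
open import Data.Nat using (_≟_)

data Step : Set where
  u r : Step   -- u = up step (0,1), r = right step (1,0)

Word : Set
Word = List Step

_≟ˢ_ : (s t : Step) → Dec (s ≡ t)
u ≟ˢ u = yes refl
u ≟ˢ r = no (λ ())
r ≟ˢ u = no (λ ())
r ≟ˢ r = yes refl

#r : Word → ℕ
#r []       = 0
#r (r ∷ w)  = suc (#r w)
#r (u ∷ w)  = #r w

#u : Word → ℕ
#u []       = 0
#u (u ∷ w)  = suc (#u w)
#u (r ∷ w)  = #u w

Ballot : Word → Set
Ballot w = All (λ pre → #r pre ≤ #u pre) (inits w)

ballot? : (w : Word) → Dec (Ballot w)
ballot? w = all? (λ pre → #r pre ≤? #u pre) (inits w)

Occurs : Word → Word → Set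
Occurs p w = Infix _≡_ p w

Avoids : Word → Word → Set
Avoids w p = ¬ Occurs p w

avoids? : (w p : Word) → Dec (Avoids w p)
avoids? w p = ¬? (infix? _≟ˢ_ p w)

swap : Step → Step
swap u = r
swap r = u

rev~ : Word → Word
rev~ p = reverse (map swap p)

DepthZero : Word → Set
DepthZero p = Ballot (rev~ p)

NonEmpty : Word → Set
NonEmpty w = w ≢ []

IsBifix : Word → Word → Set
IsBifix o p = NonEmpty o ×
  (∃[ p' ] NonEmpty p' × p ≡ o ++ p') ×
  (∃[ p'' ] NonEmpty p'' × p ≡ p'' ++ o)

front : Word → Word → Word
front p o = take (length p ∸ length o) p

allWords : ℕ → List Word
allWords zero    = [] ∷ []
allWords (suc L) = concatMap (λ w → (u ∷ w) ∷ (r ∷ w) ∷ []) (allWords L)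

sN : Word → ℕ → ℕ → ℕ
sN p n x = length (filter
  (λ w → ((#r w ≟ n) ×-dec (#u w ≟ x)) ×-dec (ballot? w ×-dec avoids? w p))
  (allWords (n ℕ.+ x)))

-- s_n(x) extended to all integers: 0 if n or x is negative
-- (for x < n there are no ballot paths, so sN is 0 there as well;
--  this gives the conventions s_n(n-1) = 0 and s_j(y) = 0 for j < 0)
s : Word → ℤ → ℤ → ℤ
s p (+ n)    (+ x)    = + sN p n x
s p (+ n)    -[1+ _ ] = 0ℤ
s p -[1+ _ ] _        = 0ℤ

sumℤ : List ℤ → ℤ
sumℤ []       = 0ℤ
sumℤ (z ∷ zs) = z ℤ.+ sumℤ zs

sumℕ : List ℕ → ℕ
sumℕ []       = 0
sumℕ (z ∷ zs) = z ℕ.+ sumℕ zs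

tuples : ℕ → ℕ → List (List ℕ)
tuples zero    zero    = [] ∷ []
tuples zero    (suc k) = []
tuples (suc m) k       = concatMap (λ i → map (i ∷_) (tuples m (k ∸ i))) (upTo (suc k))

prod!≢0 : (is : List ℕ) → NonZero (product (map _! is))
prod!≢0 []       = _
prod!≢0 (i ∷ is) = m*n≢0 (i !) (product (map _! is)) {{i !≢0}} {{prod!≢0 is}}

multinomial : ℕ → List ℕ → ℕ
multinomial k is = ℕ._/_ (k !) (product (map _! is)) {{prod!≢0 is}}

weighted : (Word → ℕ) → List Word → List ℕ → ℕ
weighted f (o ∷ os) (i ∷ is) = i ℕ.* f o ℕ.+ weighted f os is
weighted f _        _        = 0

bdim : Word → Word → ℕ
bdim p o = #r (front p o)

ddim : Word → Word → ℕ
ddim p o = #u (front p o)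

innerSum : Word → List Word → ℕ → ℕ → ℕ → ℤ
innerSum p os n x k = sumℤ (map (λ is →
    + multinomial k is ℤ.*
    s p ((+ n) ℤ.- (+ #r p) ℤ.- (+ weighted (bdim p) os is))
        ((+ x) ℤ.- (+ #u p) ℤ.- (+ weighted (ddim p) os is)))
  (tuples (length os) k))

outerSum : Word → List Word → ℕ → ℕ → ℕ → ℤ
outerSum p os n x K = sumℤ (map (λ k → (-1ℤ ℤ.^ k) ℤ.* innerSum p os n x k) (upTo (suc K)))

module Submission where

-- Write p = p₀ r (depth zero forces the last letter r; its suffixes are right-heavy) and let F(m, y)
-- count the ballot paths t to (m, y) such that p occurs in t p only at the end.  A p-avoiding path
-- to (n, x) ends in u or in r, and appending r creates p exactly when the path ends in p₀, so
-- s(n, x) = s(n-1, x) + s(n, x-1) - F(n-a, x-c).  Appending p to a p-avoiding ballot path v to (m, y),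
-- the first occurrence of p in v p is either the final one or overlaps it in a unique bifix o, and
-- then v = t p''_o with t counted by F; hence s(m, y) = F(m, y) + Σ_o F(m-b_o, y-d_o).  By Pascal's
-- rule for multinomial coefficients the alternating sum satisfies the same recurrence, and it does
-- not depend on the cutoff K ≥ n because every b_o ≥ 1; induction on m identifies the two.

module Sums where

  open import Defs
  open import Function using (_∘_)
  open import Data.Nat using (ℕ; suc; _<_)
  open import Data.Integer using (ℤ; 0ℤ; _+_; _*_)
  import Data.Integer.Properties as ℤ
  open import Data.Integer.Tactic.RingSolver using (solve-∀)
  open import Data.List using (List; []; _∷_; _++_; [_]; map; concatMap; upTo)
  import Data.List.Properties as List
  open import Data.List.Relation.Unary.All as All using (All; []; _∷_)
  import Data.List.Relation.Unary.All.Properties as All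
  open import Relation.Binary.PropositionalEquality hiding ([_])

  private variable
    A B : Set

  sumOver : List A → (A → ℤ) → ℤ
  sumOver xs f = sumℤ (map f xs)

  sumℤ-++ : ∀ xs ys → sumℤ (xs ++ ys) ≡ sumℤ xs + sumℤ ys
  sumℤ-++ []       ys = sym (ℤ.+-identityˡ _)
  sumℤ-++ (x ∷ xs) ys = trans (cong (x +_) (sumℤ-++ xs ys)) (sym (ℤ.+-assoc x _ _))

  sumOver-cong-All : {xs : List A} {f g : A → ℤ} → All (λ x → f x ≡ g x) xs → sumOver xs f ≡ sumOver xs g
  sumOver-cong-All []         = refl
  sumOver-cong-All (eq ∷ eqs) = cong₂ _+_ eq (sumOver-cong-All eqs)

  sumOver-cong : (xs : List A) {f g : A → ℤ} → (∀ x → f x ≡ g x) → sumOver xs f ≡ sumOver xs g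
  sumOver-cong xs eq = sumOver-cong-All (All.universal eq xs)

  sumOver-zero : {xs : List A} {f : A → ℤ} → All (λ x → f x ≡ 0ℤ) xs → sumOver xs f ≡ 0ℤ
  sumOver-zero []         = refl
  sumOver-zero (eq ∷ eqs) = cong₂ _+_ eq (sumOver-zero eqs)

  sumOver-+ : (xs : List A) (f g : A → ℤ) → sumOver xs (λ x → f x + g x) ≡ sumOver xs f + sumOver xs g
  sumOver-+ []       f g = refl
  sumOver-+ (x ∷ xs) f g = trans (cong (f x + g x +_) (sumOver-+ xs f g)) (interchange (f x) (g x) _ _)
    where
    interchange : ∀ a b c d → a + b + (c + d) ≡ a + c + (b + d)
    interchange = solve-∀

  sumOver-*ˡ : (xs : List A) (c : ℤ) (f : A → ℤ) → sumOver xs (λ x → c * f x) ≡ c * sumOver xs f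
  sumOver-*ˡ []       c f = sym (ℤ.*-zeroʳ c)
  sumOver-*ˡ (x ∷ xs) c f = trans (cong (c * f x +_) (sumOver-*ˡ xs c f)) (sym (ℤ.*-distribˡ-+ c (f x) _))

  sumOver-swap : (xs : List A) (ys : List B) (h : A → B → ℤ) →
    sumOver xs (λ x → sumOver ys (h x)) ≡ sumOver ys (λ y → sumOver xs (λ x → h x y))
  sumOver-swap []       ys h = sym (sumOver-zero (All.universal (λ _ → refl) ys))
  sumOver-swap (x ∷ xs) ys h = trans (cong (sumOver ys (h x) +_) (sumOver-swap xs ys h))
    (sym (sumOver-+ ys (h x) (λ y → sumOver xs (λ x′ → h x′ y))))

  sumOver-++ : (xs ys : List A) (f : A → ℤ) → sumOver (xs ++ ys) f ≡ sumOver xs f + sumOver ys f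
  sumOver-++ xs ys f = trans (cong sumℤ (List.map-++ f xs ys)) (sumℤ-++ (map f xs) (map f ys))

  sumOver-map : (xs : List A) (g : A → B) (f : B → ℤ) → sumOver (map g xs) f ≡ sumOver xs (f ∘ g)
  sumOver-map xs g f = cong sumℤ (sym (List.map-∘ xs))

  sumOver-concatMap : (xs : List A) (g : A → List B) (f : B → ℤ) →
    sumOver (concatMap g xs) f ≡ sumOver xs (λ x → sumOver (g x) f)
  sumOver-concatMap []       g f = refl
  sumOver-concatMap (x ∷ xs) g f = trans (sumOver-++ (g x) (concatMap g xs) f)
    (cong (sumOver (g x) f +_) (sumOver-concatMap xs g f))

  sumOver-upTo-suc : (n : ℕ) (f : ℕ → ℤ) → sumOver (upTo (suc n)) f ≡ f 0 + sumOver (upTo n) (f ∘ suc)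
  sumOver-upTo-suc n f = cong (λ xs → f 0 + sumℤ xs)
    (trans (List.map-applyUpTo suc f n) (sym (List.map-upTo (f ∘ suc) n)))

  sumOver-upTo-∷ʳ : (n : ℕ) (f : ℕ → ℤ) → sumOver (upTo (suc n)) f ≡ sumOver (upTo n) f + f n
  sumOver-upTo-∷ʳ n f = trans (cong (λ xs → sumOver xs f) (sym (List.upTo-∷ʳ n)))
    (trans (sumOver-++ (upTo n) [ n ] f) (cong (sumOver (upTo n) f +_) (ℤ.+-identityʳ (f n))))

  sumOver-upTo-cong : (n : ℕ) {f g : ℕ → ℤ} → (∀ {i} → i < n → f i ≡ g i) → sumOver (upTo n) f ≡ sumOver (upTo n) g
  sumOver-upTo-cong n eq = sumOver-cong-All (All.applyUpTo⁺₁ _ n eq)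

module Multinomials where

  open import Defs
  open Sums
  open import Data.Nat as ℕ using (ℕ; zero; suc; _+_; _*_; _∸_; _≤_; NonZero)
  import Data.Nat.Properties as ℕ
  open import Data.Nat.Base using (_!)
  open import Data.Nat.Combinatorics using (_C_; nCk≡n!/k![n-k]!; k![n∸k]!∣n!)
  open import Data.Nat.DivMod using (m*n/n≡m; m/n*n≡m)
  open import Data.Nat.ListAction using (product)
  open import Data.Nat.Tactic.RingSolver using (solve-∀)
  open import Data.Integer using (ℤ; +_)
  open import Data.List using (List; []; _∷_; map; upTo)
  open import Data.List.Relation.Unary.All as All using (All; []; _∷_)
  import Data.List.Relation.Unary.All.Properties as All
  open import Relation.Binary.PropositionalEquality

  binomialProduct : List ℕ → ℕ
  binomialProduct []       = 1
  binomialProduct (i ∷ is) = ((i + sumℕ is) C i) * binomialProduct is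

  binomial*factorials : ∀ i j → ((i + j) C i) * (i ! * j !) ≡ (i + j) !
  binomial*factorials i j = begin
    ((i + j) C i) * (i ! * j !)     ≡⟨ cong₂ _*_ (nCk≡n!/k![n-k]! (ℕ.m≤m+n i j)) (cong (λ m → i ! * m !) (sym (ℕ.m+n∸m≡n i j))) ⟩
    ((i + j) ! ℕ./ D) * D          ≡⟨ m/n*n≡m (k![n∸k]!∣n! (ℕ.m≤m+n i j)) ⟩
    (i + j) !                       ∎
    where
    open ≡-Reasoning
    D = i ! * (i + j ∸ i) !
    instance
      D≢0 : NonZero D
      D≢0 = ℕ.m*n≢0 (i !) ((i + j ∸ i) !) {{ℕ._!≢0 i}} {{ℕ._!≢0 (i + j ∸ i)}}

  factorials*binomialProduct : ∀ is → product (map _! is) * binomialProduct is ≡ (sumℕ is) !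
  factorials*binomialProduct []       = refl
  factorials*binomialProduct (i ∷ is) = begin
    (i ! * P) * (B * binomialProduct is)   ≡⟨ rearrange (i !) P B (binomialProduct is) ⟩
    B * (i ! * (P * binomialProduct is))   ≡⟨ cong (λ m → B * (i ! * m)) (factorials*binomialProduct is) ⟩
    B * (i ! * (sumℕ is) !)                ≡⟨ binomial*factorials i (sumℕ is) ⟩
    (i + sumℕ is) !                         ∎
    where
    open ≡-Reasoning
    P = product (map _! is)
    B = (i + sumℕ is) C i
    rearrange : ∀ a b c d → (a * b) * (c * d) ≡ c * (a * (b * d))
    rearrange = solve-∀

  multinomial≡binomialProduct : ∀ is → multinomial (sumℕ is) is ≡ binomialProduct is
  multinomial≡binomialProduct is = begin
    ((sumℕ is) ! ℕ./ P) {{prod!≢0 is}}                        ≡⟨ cong (λ m → (m ℕ./ P) {{prod!≢0 is}}) (sym (factorials*binomialProduct is)) ⟩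
    ((P * binomialProduct is) ℕ./ P) {{prod!≢0 is}}           ≡⟨ cong (λ m → (m ℕ./ P) {{prod!≢0 is}}) (ℕ.*-comm P (binomialProduct is)) ⟩
    ((binomialProduct is * P) ℕ./ P) {{prod!≢0 is}}           ≡⟨ m*n/n≡m (binomialProduct is) P {{prod!≢0 is}} ⟩
    binomialProduct is                                         ∎
    where
    open ≡-Reasoning
    P = product (map _! is)

  multinomial-∷ : ∀ k i is → i ≤ k → sumℕ is ≡ k ∸ i → multinomial k (i ∷ is) ≡ (k C i) * multinomial (k ∸ i) is
  multinomial-∷ k i is i≤k Σis≡k∸i = begin
    multinomial k (i ∷ is)                 ≡⟨ cong (λ m → multinomial m (i ∷ is)) (sym i+Σis≡k) ⟩
    multinomial (i + sumℕ is) (i ∷ is)     ≡⟨ multinomial≡binomialProduct (i ∷ is) ⟩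
    ((i + sumℕ is) C i) * binomialProduct is ≡⟨ cong₂ (λ m b → (m C i) * b) i+Σis≡k (sym (multinomial≡binomialProduct is)) ⟩
    (k C i) * multinomial (sumℕ is) is     ≡⟨ cong (λ m → (k C i) * multinomial m is) Σis≡k∸i ⟩
    (k C i) * multinomial (k ∸ i) is       ∎
    where
    open ≡-Reasoning
    i+Σis≡k : i + sumℕ is ≡ k
    i+Σis≡k = trans (cong (_+_ i) Σis≡k∸i) (ℕ.m+[n∸m]≡n i≤k)

  tuples-sum : ∀ m k → All (λ is → sumℕ is ≡ k) (tuples m k)
  tuples-sum zero    zero    = refl ∷ []
  tuples-sum zero    (suc k) = []
  tuples-sum (suc m) k       = All.concat⁺ (All.map⁺ (All.applyUpTo⁺₁ _ (suc k) λ {i} i<1+k →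
    All.map⁺ (All.map (λ Σis≡k∸i → trans (cong (_+_ i) Σis≡k∸i) (ℕ.m+[n∸m]≡n (ℕ.≤-pred i<1+k))) (tuples-sum m (k ∸ i)))))

  sumOver-tuples-suc : ∀ m k (h : List ℕ → ℤ) →
    sumOver (tuples (suc m) k) h ≡ sumOver (upTo (suc k)) (λ i → sumOver (tuples m (k ∸ i)) (λ is → h (i ∷ is)))
  sumOver-tuples-suc m k h = trans (sumOver-concatMap (upTo (suc k)) (λ i → map (i ∷_) (tuples m (k ∸ i))) h)
    (sumOver-cong (upTo (suc k)) (λ i → sumOver-map (tuples m (k ∸ i)) (i ∷_) h))

module AlternatingSums where

  open import Defs
  open Sums
  open Multinomials
  open import Data.Nat as ℕ using (ℕ; zero; suc; _∸_; _≤_; z≤n)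
  import Data.Nat.Properties as ℕ
  open import Data.Nat.Combinatorics using (_C_; nCk+nC[k+1]≡[n+1]C[k+1]; k>n⇒nCk≡0)
  open import Data.Integer as ℤ using (ℤ; +_; -[1+_]; _+_; _*_; _-_; 0ℤ; 1ℤ; -1ℤ; _^_; +≤+; +<+)
  import Data.Integer.Properties as ℤ
  open import Data.Integer.Tactic.RingSolver using (solve-∀)
  open import Data.List using (List; []; _∷_; length; upTo)
  open import Data.List.Relation.Unary.All as All using (All; []; _∷_)
  import Data.List.Relation.Unary.All.Properties as All
  open import Relation.Binary.PropositionalEquality

  Grid : Set
  Grid = ℤ → ℤ → ℤ

  module MultinomialShifts (b d : Word → ℕ) where

    shift : Word → ℕ → Grid → Grid
    shift o i f N X = f (N - + (i ℕ.* b o)) (X - + (i ℕ.* d o))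

    multiSum : List Word → ℕ → Grid → Grid
    multiSum os k f N X = sumOver (tuples (length os) k) λ is →
      + multinomial k is * f (N - + weighted b os is) (X - + weighted d os is)

    alternatingSum : List Word → ℕ → Grid → Grid
    alternatingSum os K f N X = sumOver (upTo (suc K)) λ k → -1ℤ ^ k * multiSum os k f N X

    private
      sub-+ : ∀ (N i j : ℤ) → N - (i + j) ≡ N - j - i
      sub-+ = solve-∀

      sub-comm : ∀ (N i j : ℤ) → N - i - j ≡ N - j - i
      sub-comm = solve-∀

      sub-pos-+ : ∀ N i j → N - + (i ℕ.+ j) ≡ N - + j - + i
      sub-pos-+ N i j = trans (cong (N -_) (ℤ.pos-+ i j)) (sub-+ N (+ i) (+ j))

    multiSum-cong : ∀ os k {f g : Grid} → (∀ N X → f N X ≡ g N X) → ∀ N X → multiSum os k f N X ≡ multiSum os k g N X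
    multiSum-cong os k f≗g N X = sumOver-cong (tuples (length os) k) λ is → cong (+ multinomial k is *_) (f≗g _ _)

    multiSum-∷ : ∀ o os k f N X →
      multiSum (o ∷ os) k f N X ≡ sumOver (upTo (suc k)) λ i → + (k C i) * multiSum os (k ∸ i) (shift o i f) N X
    multiSum-∷ o os k f N X = trans (sumOver-tuples-suc (length os) k _) (sumOver-upTo-cong (suc k) λ {i} i<1+k →
      trans (sumOver-cong-All (All.map (term i (ℕ.≤-pred i<1+k)) (tuples-sum (length os) (k ∸ i))))
            (sumOver-*ˡ (tuples (length os) (k ∸ i)) (+ (k C i)) _))
      where
      term : ∀ i → i ≤ k → ∀ {is} → sumℕ is ≡ k ∸ i →
        + multinomial k (i ∷ is) * f (N - + weighted b (o ∷ os) (i ∷ is)) (X - + weighted d (o ∷ os) (i ∷ is))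
          ≡ + (k C i) * (+ multinomial (k ∸ i) is * shift o i f (N - + weighted b os is) (X - + weighted d os is))
      term i i≤k {is} Σis = begin
        + multinomial k (i ∷ is) * F                        ≡⟨ cong (λ m → + m * F) (multinomial-∷ k i is i≤k Σis) ⟩
        + ((k C i) ℕ.* multinomial (k ∸ i) is) * F          ≡⟨ cong (_* F) (ℤ.pos-* (k C i) _) ⟩
        + (k C i) * + multinomial (k ∸ i) is * F            ≡⟨ ℤ.*-assoc (+ (k C i)) _ F ⟩
        + (k C i) * (+ multinomial (k ∸ i) is * F)          ≡⟨ cong (λ z → + (k C i) * (+ multinomial (k ∸ i) is * z))
                                                                 (cong₂ f (sub-pos-+ N _ _) (sub-pos-+ X _ _)) ⟩
        + (k C i) * (+ multinomial (k ∸ i) is * shift o i f (N - + weighted b os is) (X - + weighted d os is)) ∎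
        where
        open ≡-Reasoning
        F = f (N - + weighted b (o ∷ os) (i ∷ is)) (X - + weighted d (o ∷ os) (i ∷ is))

    multiSum-0 : ∀ os f N X → multiSum os 0 f N X ≡ f N X
    multiSum-0 []       f N X = trans (ℤ.+-identityʳ _) (trans (ℤ.*-identityˡ _) (cong₂ f (ℤ.+-identityʳ N) (ℤ.+-identityʳ X)))
    multiSum-0 (o ∷ os) f N X = begin
      multiSum (o ∷ os) 0 f N X                 ≡⟨ multiSum-∷ o os 0 f N X ⟩
      1ℤ * multiSum os 0 (shift o 0 f) N X + 0ℤ ≡⟨ trans (ℤ.+-identityʳ _) (ℤ.*-identityˡ _) ⟩
      multiSum os 0 (shift o 0 f) N X           ≡⟨ multiSum-0 os (shift o 0 f) N X ⟩
      shift o 0 f N X                           ≡⟨ cong₂ f (ℤ.+-identityʳ N) (ℤ.+-identityʳ X) ⟩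
      f N X                                     ∎
      where open ≡-Reasoning

    shift-shift : ∀ o i f N X → shift o i (shift o 1 f) N X ≡ shift o (suc i) f N X
    shift-shift o i f N X = cong₂ f (shifted N (b o)) (shifted X (d o))
      where
      shifted : ∀ N c → N - + (i ℕ.* c) - + (1 ℕ.* c) ≡ N - + (suc i ℕ.* c)
      shifted N c rewrite ℕ.*-identityˡ c = sym (sub-pos-+ N c (i ℕ.* c))

    shift-comm : ∀ o o′ i j f N X → shift o i (shift o′ j f) N X ≡ shift o′ j (shift o i f) N X
    shift-comm o o′ i j f N X = cong₂ f (sub-comm N _ _) (sub-comm X _ _)

    multiSum-shift : ∀ os o k f N X → multiSum os k f (N - + b o) (X - + d o) ≡ multiSum os k (shift o 1 f) N X
    multiSum-shift os o k f N X = sumOver-cong (tuples (length os) k) λ is → cong (+ multinomial k is *_)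
      (cong₂ f (shifted N (b o) (weighted b os is)) (shifted X (d o) (weighted d os is)))
      where
      shifted : ∀ N c w → N - + c - + w ≡ N - + w - + (1 ℕ.* c)
      shifted N c w rewrite ℕ.*-identityˡ c = sub-comm N (+ c) (+ w)

    -- Pascal's rule (k+1; i) = Σⱼ (k; i − eⱼ) for multinomial coefficients.
    multiSum-suc : ∀ os k f N X → multiSum os (suc k) f N X ≡ sumOver os λ o → multiSum os k (shift o 1 f) N X
    multiSum-suc []       k f N X = refl
    multiSum-suc (o ∷ os) k f N X = begin
      multiSum (o ∷ os) (suc k) f N X
        ≡⟨ expand ⟩
      A + (X₀ + B)
        ≡⟨ cong₂ _+_ (sym shiftByO) (sym shiftByOthers) ⟩
      multiSum (o ∷ os) k (shift o 1 f) N X + sumOver os (λ o′ → multiSum (o ∷ os) k (shift o′ 1 f) N X) ∎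
      where
      open ≡-Reasoning
      G : ℕ → ℕ → ℤ
      G j i = multiSum os j (shift o i f) N X
      c : ℕ → ℕ → ℤ
      c n i = + (n C i)
      A X₀ B : ℤ
      A  = sumOver (upTo (suc k)) λ i → c k i * G (k ∸ i) (suc i)
      X₀ = c k 0 * G (suc k) 0
      B  = sumOver (upTo k) λ i → c k (suc i) * G (k ∸ i) (suc i)

      expand : multiSum (o ∷ os) (suc k) f N X ≡ A + (X₀ + B)
      expand = begin
        multiSum (o ∷ os) (suc k) f N X
          ≡⟨ trans (multiSum-∷ o os (suc k) f N X) (sumOver-upTo-suc (suc k) λ i → c (suc k) i * G (suc k ∸ i) i) ⟩
        X₀ + sumOver (upTo (suc k)) (λ i → c (suc k) (suc i) * G (k ∸ i) (suc i))
          ≡⟨ cong (_+_ X₀) (trans (sumOver-cong (upTo (suc k)) pascal) (sumOver-+ (upTo (suc k)) (λ i → c k i * G (k ∸ i) (suc i)) λ i → c k (suc i) * G (k ∸ i) (suc i))) ⟩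
        X₀ + (A + sumOver (upTo (suc k)) (λ i → c k (suc i) * G (k ∸ i) (suc i)))
          ≡⟨ cong (λ z → X₀ + (A + z)) (trans (sumOver-upTo-∷ʳ k _)
               (cong (λ m → B + + m * G (k ∸ k) (suc k)) (k>n⇒nCk≡0 (ℕ.n<1+n k)))) ⟩
        X₀ + (A + (B + 0ℤ))
          ≡⟨ rearrange X₀ A B ⟩
        A + (X₀ + B) ∎
        where
        pascal : ∀ i → c (suc k) (suc i) * G (k ∸ i) (suc i) ≡ c k i * G (k ∸ i) (suc i) + c k (suc i) * G (k ∸ i) (suc i)
        pascal i = trans (cong (λ m → + m * G (k ∸ i) (suc i)) (sym (nCk+nC[k+1]≡[n+1]C[k+1] k i)))
          (trans (cong (_* G (k ∸ i) (suc i)) (ℤ.pos-+ (k C i) (k C suc i))) (ℤ.*-distribʳ-+ (G (k ∸ i) (suc i)) (c k i) (c k (suc i))))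
        rearrange : ∀ x a b → x + (a + (b + 0ℤ)) ≡ a + (x + b)
        rearrange = solve-∀

      shiftByO : multiSum (o ∷ os) k (shift o 1 f) N X ≡ A
      shiftByO = trans (multiSum-∷ o os k (shift o 1 f) N X) (sumOver-cong (upTo (suc k)) λ i →
        cong (c k i *_) (multiSum-cong os (k ∸ i) (shift-shift o i f) N X))

      shiftByOthers : sumOver os (λ o′ → multiSum (o ∷ os) k (shift o′ 1 f) N X) ≡ X₀ + B
      shiftByOthers = begin
        sumOver os (λ o′ → multiSum (o ∷ os) k (shift o′ 1 f) N X)
          ≡⟨ sumOver-cong os (λ o′ → multiSum-∷ o os k (shift o′ 1 f) N X) ⟩
        sumOver os (λ o′ → sumOver (upTo (suc k)) λ i → c k i * multiSum os (k ∸ i) (shift o i (shift o′ 1 f)) N X)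
          ≡⟨ sumOver-swap os (upTo (suc k)) _ ⟩
        sumOver (upTo (suc k)) (λ i → sumOver os λ o′ → c k i * multiSum os (k ∸ i) (shift o i (shift o′ 1 f)) N X)
          ≡⟨ sumOver-cong (upTo (suc k)) (λ i → trans (sumOver-*ˡ os (c k i) _) (cong (c k i *_)
               (trans (sumOver-cong os λ o′ → multiSum-cong os (k ∸ i) (shift-comm o o′ i 1 f) N X)
                      (sym (multiSum-suc os (k ∸ i) (shift o i f) N X))))) ⟩
        sumOver (upTo (suc k)) (λ i → c k i * G (suc (k ∸ i)) i)
          ≡⟨ sumOver-upTo-suc k (λ i → c k i * G (suc (k ∸ i)) i) ⟩
        X₀ + sumOver (upTo k) (λ i → c k (suc i) * G (suc (k ∸ suc i)) (suc i))
          ≡⟨ cong (_+_ X₀) (sumOver-upTo-cong k λ {i} i<k → cong (λ j → c k (suc i) * G j (suc i)) (sym (ℕ.+-∸-assoc 1 i<k))) ⟩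
        X₀ + B ∎

    alternatingSum-recurrence : ∀ os K f N X →
      alternatingSum os (suc K) f N X + sumOver os (λ o → alternatingSum os K f (N - + b o) (X - + d o)) ≡ f N X
    alternatingSum-recurrence os K f N X = begin
      alternatingSum os (suc K) f N X + sumOver os (λ o → alternatingSum os K f (N - + b o) (X - + d o))
        ≡⟨ cong₂ _+_ (sumOver-upTo-suc (suc K) (λ k → e k * M k)) shifted ⟩
      1ℤ * M 0 + sumOver (upTo (suc K)) (λ k → -1ℤ * e k * M (suc k)) + sumOver (upTo (suc K)) (λ k → e k * M (suc k))
        ≡⟨ ℤ.+-assoc (1ℤ * M 0) _ _ ⟩
      1ℤ * M 0 + (sumOver (upTo (suc K)) (λ k → -1ℤ * e k * M (suc k)) + sumOver (upTo (suc K)) (λ k → e k * M (suc k)))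
        ≡⟨ cong (_+_ (1ℤ * M 0)) (trans (sym (sumOver-+ (upTo (suc K)) (λ k → -1ℤ * e k * M (suc k)) λ k → e k * M (suc k)))
             (sumOver-zero (All.universal (λ k → cancel (e k) (M (suc k))) (upTo (suc K))))) ⟩
      1ℤ * M 0 + 0ℤ
        ≡⟨ trans (ℤ.+-identityʳ _) (trans (ℤ.*-identityˡ _) (multiSum-0 os f N X)) ⟩
      f N X ∎
      where
      open ≡-Reasoning
      M : ℕ → ℤ
      M k = multiSum os k f N X
      e : ℕ → ℤ
      e k = -1ℤ ^ k
      cancel : ∀ a m → -1ℤ * a * m + a * m ≡ 0ℤ
      cancel = solve-∀
      shifted : sumOver os (λ o → alternatingSum os K f (N - + b o) (X - + d o)) ≡ sumOver (upTo (suc K)) (λ k → e k * M (suc k))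
      shifted = begin
        sumOver os (λ o → alternatingSum os K f (N - + b o) (X - + d o))
          ≡⟨ sumOver-cong os (λ o → sumOver-cong (upTo (suc K)) λ k → cong (e k *_) (multiSum-shift os o k f N X)) ⟩
        sumOver os (λ o → sumOver (upTo (suc K)) λ k → e k * multiSum os k (shift o 1 f) N X)
          ≡⟨ sumOver-swap os (upTo (suc K)) _ ⟩
        sumOver (upTo (suc K)) (λ k → sumOver os λ o → e k * multiSum os k (shift o 1 f) N X)
          ≡⟨ sumOver-cong (upTo (suc K)) (λ k → trans (sumOver-*ˡ os (e k) _) (cong (e k *_) (sym (multiSum-suc os k f N X)))) ⟩
        sumOver (upTo (suc K)) (λ k → e k * M (suc k)) ∎

    alternatingSum-suc : ∀ os K f N X → multiSum os (suc K) f N X ≡ 0ℤ →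
      alternatingSum os (suc K) f N X ≡ alternatingSum os K f N X
    alternatingSum-suc os K f N X M≡0 = begin
      alternatingSum os (suc K) f N X                               ≡⟨ sumOver-upTo-∷ʳ (suc K) (λ k → -1ℤ ^ k * multiSum os k f N X) ⟩
      alternatingSum os K f N X + -1ℤ ^ suc K * multiSum os (suc K) f N X ≡⟨ cong (λ m → alternatingSum os K f N X + -1ℤ ^ suc K * m) M≡0 ⟩
      alternatingSum os K f N X + -1ℤ ^ suc K * 0ℤ                  ≡⟨ cong (_+_ (alternatingSum os K f N X)) (ℤ.*-zeroʳ (-1ℤ ^ suc K)) ⟩
      alternatingSum os K f N X + 0ℤ                                ≡⟨ ℤ.+-identityʳ _ ⟩
      alternatingSum os K f N X                                     ∎
      where open ≡-Reasoning

    k≤weighted : ∀ os → All (λ o → 1 ≤ b o) os → ∀ k → All (λ is → k ≤ weighted b os is) (tuples (length os) k)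
    k≤weighted []       _           zero    = z≤n ∷ []
    k≤weighted []       _           (suc k) = []
    k≤weighted (o ∷ os) (1≤bo ∷ bs) k       = All.concat⁺ (All.map⁺ (All.applyUpTo⁺₁ (λ i → i) (suc k) λ {i} i<1+k →
      All.map⁺ (All.map (λ {is} → bound i is (ℕ.≤-pred i<1+k)) (k≤weighted os bs (k ∸ i)))))
      where
      open ℕ.≤-Reasoning
      bound : ∀ i is → i ≤ k → k ∸ i ≤ weighted b os is → k ≤ weighted b (o ∷ os) (i ∷ is)
      bound i is i≤k k∸i≤w = begin
        k                            ≡⟨ ℕ.m+[n∸m]≡n i≤k ⟨
        i ℕ.+ (k ∸ i)                ≤⟨ ℕ.+-mono-≤ (ℕ.m≤m*n i (b o) {{ℕ.>-nonZero 1≤bo}}) k∸i≤w ⟩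
        i ℕ.* b o ℕ.+ weighted b os is ∎

    multiSum-vanishes : ∀ os → All (λ o → 1 ≤ b o) os → ∀ k f → (∀ M Y → f -[1+ M ] Y ≡ 0ℤ) →
      ∀ N X → N ℤ.< + k → multiSum os k f N X ≡ 0ℤ
    multiSum-vanishes os 1≤b k f f-vanishes N X N<k =
      sumOver-zero (All.map (λ {is} k≤w → trans (cong (+ multinomial k is *_) (vanishes (N<w k≤w) _)) (ℤ.*-zeroʳ (+ multinomial k is)))
                            (k≤weighted os 1≤b k))
      where
      N<w : ∀ {w} → k ≤ w → N - + w ℤ.< 0ℤ
      N<w {w} k≤w = subst (N - + w ℤ.<_) (ℤ.+-inverseʳ (+ w)) (ℤ.+-monoˡ-< (ℤ.- + w) (ℤ.<-≤-trans N<k (+≤+ k≤w)))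
      vanishes : ∀ {M} → M ℤ.< 0ℤ → ∀ Y → f M Y ≡ 0ℤ
      vanishes { -[1+ M ]} _ Y = f-vanishes M Y
      vanishes {+ _} (+<+ ())

module Lists where

  open import Data.Nat as ℕ using (suc; _≤_; _<_; z≤n; s≤s)
  import Data.Nat.Properties as ℕ
  open import Data.List using (List; []; _∷_; _++_; [_]; _∷ʳ_; length; take; initLast; _∷ʳ′_)
  import Data.List.Properties as List
  open import Data.Product using (∃; _×_; _,_)
  open import Data.Sum using (_⊎_; inj₁; inj₂)
  open import Data.Empty using (⊥-elim)
  open import Relation.Binary.PropositionalEquality hiding ([_])

  private variable
    A : Set

  ++-equidivisible : ∀ (a b c d : List A) → a ++ b ≡ c ++ d →
    (∃ λ e → c ≡ a ++ e × b ≡ e ++ d) ⊎ (∃ λ e → a ≡ c ++ e × d ≡ e ++ b)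
  ++-equidivisible []      b c       d eq = inj₁ (c , refl , eq)
  ++-equidivisible (x ∷ a) b []      d eq = inj₂ (x ∷ a , refl , sym eq)
  ++-equidivisible (x ∷ a) b (y ∷ c) d eq with refl ← List.∷-injectiveˡ eq with ++-equidivisible a b c d (List.∷-injectiveʳ eq)
  ... | inj₁ (e , c≡ , b≡) = inj₁ (e , cong (x ∷_) c≡ , b≡)
  ... | inj₂ (e , a≡ , d≡) = inj₂ (e , cong (x ∷_) a≡ , d≡)

  ++-prefix : ∀ (a b c d : List A) → a ++ b ≡ c ++ d → length a ≤ length c → ∃ λ e → c ≡ a ++ e
  ++-prefix a b c d eq a≤c with ++-equidivisible a b c d eq
  ... | inj₁ (e , c≡ , _)     = e , c≡
  ... | inj₂ ([] , a≡ , _)    = [] , trans (sym (List.++-identityʳ c)) (trans (sym a≡) (sym (List.++-identityʳ a)))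
  ... | inj₂ (x ∷ e , a≡ , _) = ⊥-elim (ℕ.<⇒≱ c<a a≤c)
    where
    c<a : length c < length a
    c<a = subst (length c <_) (sym (trans (cong length a≡) (List.length-++ c))) (ℕ.m<m+n (length c) (s≤s z≤n))

  ++-≡-++-length : ∀ (a b c d : List A) → a ++ b ≡ c ++ d → length b ≡ length d → b ≡ d
  ++-≡-++-length []      b []      d eq _   = eq
  ++-≡-++-length []      b (y ∷ c) d refl |b| = ⊥-elim (ℕ.m≢1+n+m (length d) (trans (sym |b|) (cong suc (List.length-++ c))))
  ++-≡-++-length (x ∷ a) b []      d refl |b| = ⊥-elim (ℕ.m≢1+n+m (length b) (trans |b| (cong suc (List.length-++ a))))
  ++-≡-++-length (x ∷ a) b (y ∷ c) d eq |b| = ++-≡-++-length a b c d (List.∷-injectiveʳ eq) |b|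

  take-length-++ : ∀ (a b : List A) → take (length a) (a ++ b) ≡ a
  take-length-++ []      b = refl
  take-length-++ (x ∷ a) b = cong (x ∷_) (take-length-++ a b)

  length-≢[] : ∀ (w : List A) → w ≢ [] → 1 ≤ length w
  length-≢[] []      w≢[] = ⊥-elim (w≢[] refl)
  length-≢[] (_ ∷ _) _    = s≤s z≤n

  ∷ʳ≢[] : ∀ (w : List A) x → w ∷ʳ x ≢ []
  ∷ʳ≢[] []      _ ()
  ∷ʳ≢[] (_ ∷ _) _ ()

  ∷ʳ-≡-++ : ∀ (a : List A) x g o → o ≢ [] → a ∷ʳ x ≡ g ++ o → ∃ λ o₀ → a ≡ g ++ o₀
  ∷ʳ-≡-++ a x g o o≢[] eq with initLast o
  ... | []        = ⊥-elim (o≢[] refl)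
  ... | o₀ ∷ʳ′ y  = o₀ , List.∷ʳ-injectiveˡ a (g ++ o₀) (trans eq (sym (List.++-assoc g o₀ [ y ])))

module Paths where

  open import Defs
  open Lists
  open import Function using (_∘_)
  open import Data.Nat as ℕ using (ℕ; zero; suc; _+_; _∸_; _≤_; _<_; z≤n; s≤s)
  import Data.Nat.Properties as ℕ
  open import Data.List using (List; []; _∷_; _++_; [_]; _∷ʳ_; length; map; reverse; inits; take; initLast; _∷ʳ′_)
  import Data.List.Properties as List
  open import Data.List.Relation.Unary.All as All using (All; []; _∷_)
  import Data.List.Relation.Unary.All.Properties as All
  open import Data.List.Relation.Binary.Pointwise using (Pointwise-≡⇒≡; ≡⇒Pointwise-≡)
  open import Data.List.Relation.Binary.Prefix.Heterogeneous as Prefix using (Prefix; _++ᵖ_)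
  open import Data.List.Relation.Binary.Prefix.Heterogeneous.Properties using (prefix?)
  open import Data.List.Relation.Binary.Infix.Heterogeneous as Infix using (here; there; MkView)
  import Data.List.Relation.Binary.Infix.Heterogeneous.Properties as Infix
  open import Data.Product using (∃; ∃₂; _×_; _,_; proj₁; proj₂)
  open import Data.Sum using (_⊎_; inj₁; inj₂; [_,_]′)
  open import Function.Bundles using (_⇔_; mk⇔)
  open import Relation.Nullary using (Dec; yes; no; ¬_)
  import Relation.Nullary.Decidable as Dec
  open import Data.Empty using (⊥; ⊥-elim)
  open import Data.Unit using (⊤; tt)
  open import Relation.Binary.PropositionalEquality hiding ([_])

  #r-++ : ∀ v w → #r (v ++ w) ≡ #r v + #r w
  #r-++ []      w = refl
  #r-++ (r ∷ v) w = cong suc (#r-++ v w)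
  #r-++ (u ∷ v) w = #r-++ v w

  #u-++ : ∀ v w → #u (v ++ w) ≡ #u v + #u w
  #u-++ []      w = refl
  #u-++ (u ∷ v) w = cong suc (#u-++ v w)
  #u-++ (r ∷ v) w = #u-++ v w

  length≡#r+#u : ∀ w → length w ≡ #r w + #u w
  length≡#r+#u []      = refl
  length≡#r+#u (r ∷ w) = cong suc (length≡#r+#u w)
  length≡#r+#u (u ∷ w) = trans (cong suc (length≡#r+#u w)) (sym (ℕ.+-suc (#r w) (#u w)))

  #r-reverse : ∀ w → #r (reverse w) ≡ #r w
  #r-reverse []      = refl
  #r-reverse (s ∷ w) rewrite List.unfold-reverse s w | #r-++ (reverse w) [ s ] | #r-reverse w with s
  ... | u = ℕ.+-identityʳ (#r w)
  ... | r = ℕ.+-comm (#r w) 1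

  #u-reverse : ∀ w → #u (reverse w) ≡ #u w
  #u-reverse []      = refl
  #u-reverse (s ∷ w) rewrite List.unfold-reverse s w | #u-++ (reverse w) [ s ] | #u-reverse w with s
  ... | r = ℕ.+-identityʳ (#u w)
  ... | u = ℕ.+-comm (#u w) 1

  #r-rev~ : ∀ w → #r (rev~ w) ≡ #u w
  #r-rev~ w = trans (#r-reverse (map swap w)) (#r-map-swap w)
    where
    #r-map-swap : ∀ w → #r (map swap w) ≡ #u w
    #r-map-swap []      = refl
    #r-map-swap (u ∷ w) = cong suc (#r-map-swap w)
    #r-map-swap (r ∷ w) = #r-map-swap w

  #u-rev~ : ∀ w → #u (rev~ w) ≡ #r w
  #u-rev~ w = trans (#u-reverse (map swap w)) (#u-map-swap w)
    where
    #u-map-swap : ∀ w → #u (map swap w) ≡ #r w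
    #u-map-swap []      = refl
    #u-map-swap (u ∷ w) = #u-map-swap w
    #u-map-swap (r ∷ w) = cong suc (#u-map-swap w)

  BallotFrom : ℕ → Word → Set
  BallotFrom h       []      = ⊤
  BallotFrom h       (u ∷ w) = BallotFrom (suc h) w
  BallotFrom zero    (r ∷ w) = ⊥
  BallotFrom (suc h) (r ∷ w) = BallotFrom h w

  height : ℕ → Word → ℕ
  height h w = h + #u w ∸ #r w

  BallotFrom⇒endpoint : ∀ h w → BallotFrom h w → #r w ≤ h + #u w
  BallotFrom⇒endpoint h       []      _ = z≤n
  BallotFrom⇒endpoint h       (u ∷ w) b = subst (#r w ≤_) (sym (ℕ.+-suc h (#u w))) (BallotFrom⇒endpoint (suc h) w b)
  BallotFrom⇒endpoint (suc h) (r ∷ w) b = s≤s (BallotFrom⇒endpoint h w b)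

  BallotFrom-++⁻ : ∀ h v w → BallotFrom h (v ++ w) → BallotFrom h v × BallotFrom (height h v) w
  BallotFrom-++⁻ h       []      w b = tt , subst (λ k → BallotFrom k w) (sym (ℕ.+-identityʳ h)) b
  BallotFrom-++⁻ h       (u ∷ v) w b with BallotFrom-++⁻ (suc h) v w b
  ... | bv , bw = bv , subst (λ k → BallotFrom (k ∸ #r v) w) (sym (ℕ.+-suc h (#u v))) bw
  BallotFrom-++⁻ (suc h) (r ∷ v) w b = BallotFrom-++⁻ h v w b

  BallotFrom-++⁺ : ∀ h v w → BallotFrom h v → BallotFrom (height h v) w → BallotFrom h (v ++ w)
  BallotFrom-++⁺ h       []      w _  bw = subst (λ k → BallotFrom k w) (ℕ.+-identityʳ h) bw
  BallotFrom-++⁺ h       (u ∷ v) w bv bw = BallotFrom-++⁺ (suc h) v w bv (subst (λ k → BallotFrom (k ∸ #r v) w) (ℕ.+-suc h (#u v)) bw)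
  BallotFrom-++⁺ (suc h) (r ∷ v) w bv bw = BallotFrom-++⁺ h v w bv bw

  private
    BallotAbove : ℕ → Word → Set
    BallotAbove h w = All (λ pre → #r pre ≤ h + #u pre) (inits w)

    BallotAbove⇒BallotFrom : ∀ h w → BallotAbove h w → BallotFrom h w
    BallotAbove⇒BallotFrom h       []      _        = tt
    BallotAbove⇒BallotFrom h       (u ∷ w) (_ ∷ bs) = BallotAbove⇒BallotFrom (suc h) w
      (All.map (λ {pre} → subst (#r pre ≤_) (ℕ.+-suc h (#u pre))) (All.map⁻ bs))
    BallotAbove⇒BallotFrom zero    (r ∷ w) (_ ∷ bs) with All.map⁻ bs
    ... | () ∷ _
    BallotAbove⇒BallotFrom (suc h) (r ∷ w) (_ ∷ bs) = BallotAbove⇒BallotFrom h w (All.map ℕ.≤-pred (All.map⁻ bs))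

    BallotFrom⇒BallotAbove : ∀ h w → BallotFrom h w → BallotAbove h w
    BallotFrom⇒BallotAbove h       []      _ = z≤n ∷ []
    BallotFrom⇒BallotAbove h       (u ∷ w) b = z≤n ∷ All.map⁺
      (All.map (λ {pre} → subst (#r pre ≤_) (sym (ℕ.+-suc h (#u pre)))) (BallotFrom⇒BallotAbove (suc h) w b))
    BallotFrom⇒BallotAbove (suc h) (r ∷ w) b = z≤n ∷ All.map⁺ (All.map s≤s (BallotFrom⇒BallotAbove h w b))

  Ballot⇒BallotFrom : ∀ w → Ballot w → BallotFrom 0 w
  Ballot⇒BallotFrom = BallotAbove⇒BallotFrom 0

  BallotFrom⇒Ballot : ∀ w → BallotFrom 0 w → Ballot w
  BallotFrom⇒Ballot = BallotFrom⇒BallotAbove 0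

  Ballot⇒endpoint : ∀ w → Ballot w → #r w ≤ #u w
  Ballot⇒endpoint w b = BallotFrom⇒endpoint 0 w (Ballot⇒BallotFrom w b)

  Ballot-++⁻ : ∀ v w → Ballot (v ++ w) → Ballot v
  Ballot-++⁻ v w b = BallotFrom⇒Ballot v (proj₁ (BallotFrom-++⁻ 0 v w (Ballot⇒BallotFrom (v ++ w) b)))

  Ballot-∷ʳu : ∀ v → Ballot v → Ballot (v ++ [ u ])
  Ballot-∷ʳu v b = BallotFrom⇒Ballot (v ++ [ u ]) (BallotFrom-++⁺ 0 v [ u ] (Ballot⇒BallotFrom v b) tt)

  endpoint-∷ʳr : ∀ v → #r v < #u v → #r (v ++ [ r ]) ≤ #u (v ++ [ r ])
  endpoint-∷ʳr v = subst₂ _≤_ (sym (trans (#r-++ v [ r ]) (ℕ.+-comm (#r v) 1))) (sym (trans (#u-++ v [ r ]) (ℕ.+-identityʳ (#u v))))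

  RightHeavySuffixes : Word → Set
  RightHeavySuffixes []      = ⊤
  RightHeavySuffixes (s ∷ w) = #u (s ∷ w) ≤ #r (s ∷ w) × RightHeavySuffixes w

  RightHeavySuffixes⇒#u≤#r : ∀ w → RightHeavySuffixes w → #u w ≤ #r w
  RightHeavySuffixes⇒#u≤#r []      _       = z≤n
  RightHeavySuffixes⇒#u≤#r (s ∷ w) (le , _) = le

  RightHeavySuffixes⇒1≤#r : ∀ w → w ≢ [] → RightHeavySuffixes w → 1 ≤ #r w
  RightHeavySuffixes⇒1≤#r []      w≢[] _        = ⊥-elim (w≢[] refl)
  RightHeavySuffixes⇒1≤#r (r ∷ w) _    _        = s≤s z≤n
  RightHeavySuffixes⇒1≤#r (u ∷ w) _    (le , _) = ℕ.≤-trans (s≤s z≤n) le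

  RightHeavySuffixes-++⁻ : ∀ v w → RightHeavySuffixes (v ++ w) → RightHeavySuffixes w
  RightHeavySuffixes-++⁻ []      w h       = h
  RightHeavySuffixes-++⁻ (s ∷ v) w (_ , h) = RightHeavySuffixes-++⁻ v w h

  RightHeavySuffixes-++⁺ : ∀ v w → RightHeavySuffixes v → RightHeavySuffixes w → RightHeavySuffixes (v ++ w)
  RightHeavySuffixes-++⁺ []      w _        hw = hw
  RightHeavySuffixes-++⁺ (s ∷ v) w (le , hv) hw =
    subst₂ _≤_ (sym (#u-++ (s ∷ v) w)) (sym (#r-++ (s ∷ v) w)) (ℕ.+-mono-≤ le (RightHeavySuffixes⇒#u≤#r w hw)) ,
    RightHeavySuffixes-++⁺ v w hv hw

  -- A path with right-heavy suffixes is lowest at its end.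
  BallotFrom-rightHeavy : ∀ h w → RightHeavySuffixes w → #r w ≤ h + #u w → BallotFrom h w
  BallotFrom-rightHeavy h       []      _        _  = tt
  BallotFrom-rightHeavy h       (u ∷ w) (_ , hw) le = BallotFrom-rightHeavy (suc h) w hw (subst (#r w ≤_) (ℕ.+-suc h (#u w)) le)
  BallotFrom-rightHeavy zero    (r ∷ w) (_ , hw) le = ⊥-elim (ℕ.<⇒≱ le (RightHeavySuffixes⇒#u≤#r w hw))
  BallotFrom-rightHeavy (suc h) (r ∷ w) (_ , hw) le = BallotFrom-rightHeavy h w hw (ℕ.≤-pred le)

  Ballot-++⁺ : ∀ v w → RightHeavySuffixes w → #r (v ++ w) ≤ #u (v ++ w) → Ballot v → Ballot (v ++ w)
  Ballot-++⁺ v w hw endpoint bv = BallotFrom⇒Ballot (v ++ w)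
    (BallotFrom-++⁺ 0 v w bv′ (BallotFrom-rightHeavy (height 0 v) w hw w-endpoint))
    where
    bv′ = Ballot⇒BallotFrom v bv
    k = #u v ∸ #r v
    #uv≡#rv+k : #u v ≡ #r v + k
    #uv≡#rv+k = sym (ℕ.m+[n∸m]≡n (BallotFrom⇒endpoint 0 v bv′))
    w-endpoint : #r w ≤ height 0 v + #u w
    w-endpoint = ℕ.+-cancelˡ-≤ (#r v) (#r w) (k + #u w) (subst₂ _≤_ (#r-++ v w)
      (trans (#u-++ v w) (trans (cong (_+ #u w) #uv≡#rv+k) (ℕ.+-assoc (#r v) k (#u w)))) endpoint)

  Ballot-∷ʳr : ∀ v → #r v < #u v → Ballot v → Ballot (v ++ [ r ])
  Ballot-∷ʳr v v-above = Ballot-++⁺ v [ r ] (z≤n , tt) (endpoint-∷ʳr v v-above)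

  DepthZero⇒RightHeavySuffixes : ∀ w → DepthZero w → RightHeavySuffixes w
  DepthZero⇒RightHeavySuffixes []      _ = tt
  DepthZero⇒RightHeavySuffixes (s ∷ w) b =
    subst₂ _≤_ (#r-rev~ (s ∷ w)) (#u-rev~ (s ∷ w)) (Ballot⇒endpoint (rev~ (s ∷ w)) b) ,
    DepthZero⇒RightHeavySuffixes w (Ballot-++⁻ (rev~ w) [ swap s ] (subst Ballot (List.unfold-reverse (swap s) (map swap w)) b))

  DepthZero-∷ʳ : ∀ p → p ≢ [] → DepthZero p → ∃ λ p₀ → p ≡ p₀ ++ [ r ]
  DepthZero-∷ʳ p p≢[] dz with initLast p
  ... | []        = ⊥-elim (p≢[] refl)
  ... | p₀ ∷ʳ′ s  with RightHeavySuffixes-++⁻ p₀ [ s ] (DepthZero⇒RightHeavySuffixes (p₀ ∷ʳ s) dz)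
  ...   | le , _ with s
  ...     | r = p₀ , refl
  ...     | u with () ← le

  occursAt : ∀ {p} a b → Occurs p (a ++ p ++ b)
  occursAt a b = Infix.fromView (MkView a (≡⇒Pointwise-≡ refl) b)

  prefix⇒++ : ∀ {a w : Word} → Prefix _≡_ a w → ∃ λ y → w ≡ a ++ y
  prefix⇒++ pre with pw Prefix.++ y ← Prefix.toView pre = y , cong (_++ y) (sym (Pointwise-≡⇒≡ pw))

  occurrence : ∀ {p w} → Occurs p w → ∃₂ λ a b → w ≡ a ++ p ++ b
  occurrence oc with MkView a pw b ← Infix.toView oc = a , b , cong (λ i → a ++ i ++ b) (sym (Pointwise-≡⇒≡ pw))

  EndsWith : Word → Word → Set
  EndsWith g w = ∃ λ t → w ≡ t ++ g

  Suffixed : Word → (Word → Set) → Word → Set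
  Suffixed g P w = ∃ λ t → w ≡ t ++ g × P t

  endsWith? : ∀ g w → Dec (EndsWith g w)
  endsWith? g w with List.≡-dec _≟ˢ_ w g
  ... | yes w≡g = yes ([] , w≡g)
  endsWith? g []      | no w≢g = no λ { ([] , eq) → w≢g eq }
  endsWith? g (s ∷ w) | no w≢g = Dec.map′ (λ (t , eq) → s ∷ t , cong (s ∷_) eq) drop-s (endsWith? g w)
    where
    drop-s : EndsWith g (s ∷ w) → EndsWith g w
    drop-s ([]    , eq) = ⊥-elim (w≢g eq)
    drop-s (_ ∷ t , eq) = t , List.∷-injectiveʳ eq

  Suffixed-++ : ∀ {g P t} → Suffixed g P (t ++ g) ⇔ P t
  Suffixed-++ {g} {t = t} = mk⇔ (λ (t′ , eq , pt′) → subst _ (sym (List.++-cancelʳ g t t′ eq)) pt′) (λ pt → t , refl , pt)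

  suffixed? : ∀ g {P : Word → Set} → (∀ t → Dec (P t)) → ∀ w → Dec (Suffixed g P w)
  suffixed? g P? w with endsWith? g w
  ... | no ¬ends = no λ (t , eq , _) → ¬ends (t , eq)
  ... | yes (t , eq) = Dec.map′ (λ pt → t , eq , pt)
    (λ (t′ , eq′ , pt′) → subst _ (List.++-cancelʳ g t′ t (trans (sym eq′) eq)) pt′) (P? t)

  front-++ : ∀ {w} g o → w ≡ g ++ o → front w o ≡ g
  front-++ g o refl = trans (cong (λ k → take k (g ++ o))
    (trans (cong (_∸ length o) (List.length-++ g)) (ℕ.m+n∸n≡m (length g) (length o)))) (take-length-++ g o)

  bifix-front : ∀ {o w} → IsBifix o w → w ≡ front w o ++ o × front w o ≢ []
  bifix-front {o} (_ , _ , g , g≢[] , w≡go) with refl ← front-++ g o w≡go = w≡go , g≢[]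

  bifix-overlap : ∀ {o w} → IsBifix o w → ∃ λ q → q ≢ [] × w ≡ o ++ q × front w o ++ w ≡ w ++ q
  bifix-overlap {o} {w} bifix@(_ , (q , q≢[] , w≡oq) , _) = q , q≢[] , w≡oq , (begin
    g ++ w        ≡⟨ cong (g ++_) w≡oq ⟩
    g ++ o ++ q   ≡⟨ List.++-assoc g o q ⟨
    (g ++ o) ++ q ≡⟨ cong (_++ q) (proj₁ (bifix-front bifix)) ⟨
    w ++ q        ∎)
    where
    open ≡-Reasoning
    g = front w o

  bifix-dims : ∀ {o w} → RightHeavySuffixes w → IsBifix o w → ddim w o ≤ bdim w o × 1 ≤ bdim w o
  bifix-dims {o} {w} hw bifix with q , q≢[] , w≡oq , gw≡wq ← bifix-overlap bifix = d≤b , 1≤b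
    where
    g = front w o
    hq : RightHeavySuffixes q
    hq = RightHeavySuffixes-++⁻ o q (subst RightHeavySuffixes w≡oq hw)
    #rg≡#rq : #r g ≡ #r q
    #rg≡#rq = ℕ.+-cancelʳ-≡ (#r w) (#r g) (#r q)
      (trans (sym (#r-++ g w)) (trans (cong #r gw≡wq) (trans (#r-++ w q) (ℕ.+-comm (#r w) (#r q)))))
    #ug≡#uq : #u g ≡ #u q
    #ug≡#uq = ℕ.+-cancelʳ-≡ (#u w) (#u g) (#u q)
      (trans (sym (#u-++ g w)) (trans (cong #u gw≡wq) (trans (#u-++ w q) (ℕ.+-comm (#u w) (#u q)))))
    d≤b : #u g ≤ #r g
    d≤b = subst₂ _≤_ (sym #ug≡#uq) (sym #rg≡#rq) (RightHeavySuffixes⇒#u≤#r q hq)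
    1≤b : 1 ≤ #r g
    1≤b = subst (1 ≤_) (sym #rg≡#rq) (RightHeavySuffixes⇒1≤#r q q≢[] hq)

  module Pattern (p₀ : Word) where

    p : Word
    p = p₀ ++ [ r ]

    length-p : length p ≡ suc (length p₀)
    length-p = trans (List.length-++ p₀) (ℕ.+-comm (length p₀) 1)

    Good : Word → Set
    Good w = Ballot w × Avoids w p

    -- t ++ p has its first occurrence of p at the very end
    GoodPrefix : Word → Set
    GoodPrefix t = Ballot t × Avoids (t ++ p₀) p

    p₀-avoids : Avoids p₀ p
    p₀-avoids oc = ℕ.<⇒≱ (ℕ.≤-reflexive (sym length-p)) (Infix.length-mono oc)

    firstOccurrence : ∀ w → Occurs p w → ∃₂ λ t y → w ≡ t ++ p ++ y × Avoids (t ++ p₀) p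
    firstOccurrence w (here pre) with y , w≡py ← prefix⇒++ pre = [] , y , w≡py , p₀-avoids
    firstOccurrence (s ∷ w) (there oc) with prefix? _≟ˢ_ p (s ∷ w)
    ... | yes pre = firstOccurrence (s ∷ w) (here pre)
    ... | no ¬pre with t , y , w≡tpy , avoid ← firstOccurrence w oc = s ∷ t , y , cong (s ∷_) w≡tpy , avoid′
      where
      extend : (t ++ p₀) ++ r ∷ y ≡ w
      extend = trans (List.++-assoc t p₀ (r ∷ y)) (trans (cong (t ++_) (sym (List.++-assoc p₀ [ r ] y))) (sym w≡tpy))
      avoid′ : Avoids (s ∷ t ++ p₀) p
      avoid′ (here pre′) = ¬pre (subst (Prefix _≡_ p) (cong (s ∷_) extend) (pre′ ++ᵖ (r ∷ y)))
      avoid′ (there oc′) = avoid oc′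

    -- A second copy of p starting strictly inside p ends before the last letter of e ++ p.
    self-overlap-occurs : ∀ e q q′ → e ≢ [] → p ++ q ≡ e ++ p ++ q′ → Occurs p (e ++ p₀)
    self-overlap-occurs e q q′ e≢[] eq = subst (Occurs p) (sym (proj₂ e₀≡pg)) (occursAt [] (proj₁ e₀≡pg))
      where
      eq′ : p ++ q ≡ (e ++ p₀) ++ r ∷ q′
      eq′ = trans eq (trans (cong (e ++_) (List.++-assoc p₀ [ r ] q′)) (sym (List.++-assoc e p₀ (r ∷ q′))))
      p≤e₀ : length p ≤ length (e ++ p₀)
      p≤e₀ = subst₂ _≤_ (sym length-p) (sym (List.length-++ e)) (ℕ.+-monoˡ-≤ (length p₀) (length-≢[] e e≢[]))
      e₀≡pg : ∃ λ g → e ++ p₀ ≡ p ++ g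
      e₀≡pg = ++-prefix p q (e ++ p₀) (r ∷ q′) eq′ p≤e₀

    firstOccurrence-unique : ∀ t t′ q q′ → t ++ p ++ q ≡ t′ ++ p ++ q′ →
      Avoids (t ++ p₀) p → Avoids (t′ ++ p₀) p → t ≡ t′
    firstOccurrence-unique t t′ q q′ eq avoid avoid′ with ++-equidivisible t (p ++ q) t′ (p ++ q′) eq
    ... | inj₁ ([] , t′≡t , _) = sym (trans t′≡t (List.++-identityʳ t))
    ... | inj₂ ([] , t≡t′ , _) = trans t≡t′ (List.++-identityʳ t′)
    ... | inj₁ (e@(_ ∷ _) , t′≡te , pq≡epq′) = ⊥-elim (avoid′ (subst (Occurs p)
            (trans (sym (List.++-assoc t e p₀)) (cong (_++ p₀) (sym t′≡te))) (t Infix.++ⁱ self-overlap-occurs e q q′ (λ ()) pq≡epq′)))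
    ... | inj₂ (e@(_ ∷ _) , t≡t′e , pq′≡epq) = ⊥-elim (avoid (subst (Occurs p)
            (trans (sym (List.++-assoc t′ e p₀)) (cong (_++ p₀) (sym t≡t′e))) (t′ Infix.++ⁱ self-overlap-occurs e q′ q (λ ()) pq′≡epq)))

    straddle : ∀ v t y → v ++ p₀ ≡ t ++ p ++ y → Avoids v p →
      ∃₂ λ g o → v ≡ t ++ g × p ≡ g ++ o × g ≢ [] × o ≢ [] × ∃ λ y′ → p₀ ≡ o ++ y′
    straddle v t y eq avoid with ++-equidivisible v p₀ t (p ++ y) eq
    ... | inj₁ (e , _ , p₀≡epy) = ⊥-elim (p₀-avoids (subst (Occurs p) (sym p₀≡epy) (occursAt e y)))
    ... | inj₂ ([] , _ , py≡p₀) = ⊥-elim (p₀-avoids (subst (Occurs p) py≡p₀ (occursAt [] y)))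
    ... | inj₂ (g@(_ ∷ _) , v≡tg , py≡gp₀) with ++-equidivisible p y g p₀ py≡gp₀
    ...   | inj₁ (o , g≡po , _) = ⊥-elim (avoid (subst (Occurs p) (sym (trans v≡tg (cong (t ++_) g≡po))) (occursAt t o)))
    ...   | inj₂ ([] , p≡g , _) = ⊥-elim (avoid (subst (Occurs p)
            (sym (trans v≡tg (cong (t ++_) (trans (sym (List.++-identityʳ g)) (trans (sym p≡g) (sym (List.++-identityʳ p))))))) (occursAt t [])))
    ...   | inj₂ (o@(_ ∷ _) , p≡go , p₀≡oy) = g , o , v≡tg , p≡go , (λ ()) , (λ ()) , y , p₀≡oy

    Good⇒Suffixed-bifix : ∀ v → Good v → Occurs p (v ++ p₀) → ∃ λ o → IsBifix o p × Suffixed (front p o) GoodPrefix v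
    Good⇒Suffixed-bifix v (ballot , avoid) oc
      with t , y , eq , avoidₜ ← firstOccurrence (v ++ p₀) oc
      with g , o , v≡tg , p≡go , g≢[] , o≢[] , y′ , p₀≡oy′ ← straddle v t y eq avoid =
      o , bifix , t , trans v≡tg (cong (t ++_) (sym (front-++ g o p≡go))) , Ballot-++⁻ t g (subst Ballot v≡tg ballot) , avoidₜ
      where
      bifix : IsBifix o p
      bifix = o≢[] , (y′ ∷ʳ r , ∷ʳ≢[] y′ r , trans (cong (_∷ʳ r) p₀≡oy′) (List.++-assoc o y′ [ r ])) , (g , g≢[] , p≡go)

    Suffixed-bifix-unique : ∀ {o o′ v} → IsBifix o p → IsBifix o′ p →
      Suffixed (front p o) GoodPrefix v → Suffixed (front p o′) GoodPrefix v → o ≡ o′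
    Suffixed-bifix-unique {o} {o′} {v} bifix bifix′ (t , v≡tg , _ , avoid) (t′ , v≡t′g′ , _ , avoid′)
      with q , _ , _ , gp≡pq ← bifix-overlap bifix
      with q′ , _ , _ , g′p≡pq′ ← bifix-overlap bifix′ = o≡o′
      where
      g = front p o
      g′ = front p o′
      t≡t′ : t ≡ t′
      t≡t′ = firstOccurrence-unique t t′ q q′ (begin
        t ++ p ++ q    ≡⟨ cong (t ++_) gp≡pq ⟨
        t ++ g ++ p    ≡⟨ List.++-assoc t g p ⟨
        (t ++ g) ++ p  ≡⟨ cong (_++ p) (trans (sym v≡tg) v≡t′g′) ⟩
        (t′ ++ g′) ++ p ≡⟨ List.++-assoc t′ g′ p ⟩
        t′ ++ g′ ++ p  ≡⟨ cong (t′ ++_) g′p≡pq′ ⟩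
        t′ ++ p ++ q′  ∎) avoid avoid′
        where open ≡-Reasoning
      g≡g′ : g ≡ g′
      g≡g′ = List.++-cancelˡ t g g′ (trans (sym v≡tg) (trans v≡t′g′ (cong (_++ g′) (sym t≡t′))))
      o≡o′ : o ≡ o′
      o≡o′ = List.++-cancelˡ g o o′ (trans (sym (proj₁ (bifix-front bifix)))
               (trans (proj₁ (bifix-front bifix′)) (cong (_++ o′) (sym g≡g′))))

    Suffixed-bifix⇒Good : RightHeavySuffixes p → ∀ {o v} → IsBifix o p → Suffixed (front p o) GoodPrefix v →
      #r (v ++ p) ≤ #u (v ++ p) → Good v × Occurs p (v ++ p₀)
    Suffixed-bifix⇒Good hp {o} bifix (t , refl , ballotₜ , avoidₜ) endpoint
      with q , q≢[] , p≡oq , gp≡pq ← bifix-overlap bifix = (ballot , avoid) , occurs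
      where
      g = front p o
      tgp≡tpq : (t ++ g) ++ p ≡ t ++ p ++ q
      tgp≡tpq = trans (List.++-assoc t g p) (cong (t ++_) gp≡pq)
      ballot : Ballot (t ++ g)
      ballot = Ballot-++⁻ (t ++ g) p (subst Ballot (sym tgp≡tpq) (Ballot-++⁺ t (p ++ q)
        (RightHeavySuffixes-++⁺ p q hp (RightHeavySuffixes-++⁻ o q (subst RightHeavySuffixes p≡oq hp)))
        (subst (λ w → #r w ≤ #u w) tgp≡tpq endpoint) ballotₜ))
      avoid : Avoids (t ++ g) p
      avoid oc with o₀ , p₀≡go₀ ← ∷ʳ-≡-++ p₀ r g o (proj₁ bifix) (proj₁ (bifix-front bifix)) =
        avoidₜ (subst (Occurs p) (trans (List.++-assoc t g o₀) (cong (t ++_) (sym p₀≡go₀))) (oc Infix.ⁱ++ o₀))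
      occurs : Occurs p ((t ++ g) ++ p₀)
      occurs with q₀ , gp₀≡pq₀ ← ∷ʳ-≡-++ (g ++ p₀) r p q q≢[] (trans (List.++-assoc g p₀ [ r ]) gp≡pq) =
        subst (Occurs p) (sym (trans (List.++-assoc t g p₀) (cong (t ++_) gp₀≡pq₀))) (occursAt t q₀)

    occurs-∷ʳ : ∀ v s → Occurs p (v ++ [ s ]) → Occurs p v ⊎ (s ≡ r × EndsWith p₀ v)
    occurs-∷ʳ v s oc with a , b , eq ← occurrence oc with initLast b
    ... | [] = inj₂ (List.∷ʳ-injectiveʳ v (a ++ p₀) eq′ , a , List.∷ʳ-injectiveˡ v (a ++ p₀) eq′)
      where
      eq′ : v ∷ʳ s ≡ (a ++ p₀) ∷ʳ r
      eq′ = trans eq (trans (cong (a ++_) (List.++-identityʳ p)) (sym (List.++-assoc a p₀ [ r ])))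
    ... | b₀ ∷ʳ′ s′ = inj₁ (subst (Occurs p) (sym (List.∷ʳ-injectiveˡ v (a ++ p ++ b₀) eq′)) (occursAt a b₀))
      where
      eq′ : v ∷ʳ s ≡ (a ++ p ++ b₀) ∷ʳ s′
      eq′ = trans eq (trans (cong (a ++_) (sym (List.++-assoc p b₀ [ s′ ]))) (sym (List.++-assoc a (p ++ b₀) [ s′ ])))

    Good-∷ʳu : ∀ v → Good (v ++ [ u ]) ⇔ Good v
    Good-∷ʳu v = mk⇔ (λ (ballot , avoid) → Ballot-++⁻ v [ u ] ballot , λ oc → avoid (oc Infix.ⁱ++ [ u ]))
                     (λ (ballot , avoid) → Ballot-∷ʳu v ballot , λ oc → [ avoid , (λ { (() , _) }) ]′ (occurs-∷ʳ v u oc))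

    Good-∷ʳr : ∀ v → #r v < #u v → Good (v ++ [ r ]) ⇔ (Good v × ¬ EndsWith p₀ v)
    Good-∷ʳr v v-above = mk⇔ to from
      where
      to : Good (v ++ [ r ]) → Good v × ¬ EndsWith p₀ v
      to (ballot , avoid) = (Ballot-++⁻ v [ r ] ballot , λ oc → avoid (oc Infix.ⁱ++ [ r ])) ,
        λ (t , v≡tp₀) → avoid (subst (Occurs p)
          (trans (cong (t ++_) (List.++-identityʳ p)) (trans (sym (List.++-assoc t p₀ [ r ])) (cong (_∷ʳ r) (sym v≡tp₀))))
          (occursAt t []))
      from : Good v × ¬ EndsWith p₀ v → Good (v ++ [ r ])
      from ((ballot , avoid) , ¬ends) = Ballot-∷ʳr v v-above ballot , λ oc → [ avoid , ¬ends ∘ proj₂ ]′ (occurs-∷ʳ v r oc)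

    Suffixed-p₀⇔ : RightHeavySuffixes p → ∀ v → #r v < #u v → Suffixed p₀ GoodPrefix v ⇔ (Good v × EndsWith p₀ v)
    Suffixed-p₀⇔ hp v v-above = mk⇔ (to v v-above) from
      where
      to : ∀ v → #r v < #u v → Suffixed p₀ GoodPrefix v → Good v × EndsWith p₀ v
      to _ t₀-above (t , refl , ballotₜ , avoidₜ) = (ballot , avoidₜ) , t , refl
        where
        ballot : Ballot (t ++ p₀)
        ballot = Ballot-++⁻ (t ++ p₀) [ r ] (subst Ballot (sym (List.++-assoc t p₀ [ r ]))
          (Ballot-++⁺ t p hp (subst (λ w → #r w ≤ #u w) (List.++-assoc t p₀ [ r ]) (endpoint-∷ʳr (t ++ p₀) t₀-above)) ballotₜ))
      from : Good v × EndsWith p₀ v → Suffixed p₀ GoodPrefix v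
      from ((ballot , avoid) , t , v≡tp₀) = t , v≡tp₀ , Ballot-++⁻ t p₀ (subst Ballot v≡tp₀ ballot) , subst (λ w → Avoids w p) v≡tp₀ avoid

    GoodPrefix⇔ : ∀ v → GoodPrefix v ⇔ (Good v × ¬ Occurs p (v ++ p₀))
    GoodPrefix⇔ v = mk⇔ (λ (ballot , avoid) → (ballot , λ oc → avoid (oc Infix.ⁱ++ p₀)) , avoid)
                        (λ ((ballot , _) , avoid) → ballot , avoid)

module PathSums where

  open import Defs
  open Sums
  open Lists
  open Paths
  open import Function using (_∘_)
  open import Function.Bundles using (_⇔_; mk⇔; Equivalence)
  open import Data.Nat as ℕ using (ℕ; zero; suc; _∸_; _≤_; _<_; _≟_)
  import Data.Nat.Properties as ℕ
  open import Data.Integer as ℤ using (ℤ; +_; -[1+_]; _+_; _*_; _-_; 0ℤ; 1ℤ)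
  import Data.Integer.Properties as ℤ
  open import Data.Integer.Tactic.RingSolver using (solve-∀)
  open import Data.Nat.Tactic.RingSolver renaming (solve-∀ to ℕ-solve-∀)
  open import Data.List using (List; []; _∷_; _++_; [_]; length; filter; concatMap)
  import Data.List.Properties as List
  open import Data.List.Relation.Unary.All as All using (All; []; _∷_)
  open import Data.List.Relation.Unary.Any using (here; there)
  open import Data.List.Relation.Unary.Unique.Propositional using (Unique)
  open import Data.List.Relation.Unary.AllPairs using (_∷_)
  open import Data.List.Membership.Propositional using (_∈_)
  open import Data.Product using (∃; _×_; _,_; proj₁; proj₂)
  open import Data.Empty using (⊥-elim)
  open import Relation.Nullary using (Dec; yes; no; ¬_; ¬?)
  open import Relation.Nullary.Decidable using (_×-dec_)
  open import Relation.Unary using (Pred; Decidable)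
  open import Relation.Binary.PropositionalEquality hiding ([_])

  private variable
    A B : Set

  𝟙 : Dec A → ℤ
  𝟙 (yes _) = 1ℤ
  𝟙 (no _)  = 0ℤ

  𝟙-yes : (a? : Dec A) → A → 𝟙 a? ≡ 1ℤ
  𝟙-yes (yes _) _ = refl
  𝟙-yes (no ¬a) a = ⊥-elim (¬a a)

  𝟙-no : (a? : Dec A) → ¬ A → 𝟙 a? ≡ 0ℤ
  𝟙-no (yes a) ¬a = ⊥-elim (¬a a)
  𝟙-no (no _)  _  = refl

  𝟙-⇔ : (a? : Dec A) (b? : Dec B) → A ⇔ B → 𝟙 a? ≡ 𝟙 b?
  𝟙-⇔ (yes a) b? A⇔B = sym (𝟙-yes b? (Equivalence.to A⇔B a))
  𝟙-⇔ (no ¬a) b? A⇔B = sym (𝟙-no b? (¬a ∘ Equivalence.from A⇔B))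

  𝟙-split : (a? : Dec A) (b? : Dec B) → 𝟙 (a? ×-dec ¬? b?) + 𝟙 (a? ×-dec b?) ≡ 𝟙 a?
  𝟙-split (yes _) (yes _) = refl
  𝟙-split (yes _) (no _)  = refl
  𝟙-split (no _)  _       = refl

  length-filter : {P : Pred A _} (P? : Decidable P) (xs : List A) → + length (filter P? xs) ≡ sumOver xs (𝟙 ∘ P?)
  length-filter P? []       = refl
  length-filter P? (x ∷ xs) with P? x
  ... | yes _ = trans (ℤ.pos-+ 1 _) (cong (_+_ 1ℤ) (length-filter P? xs))
  ... | no _  = trans (length-filter P? xs) (sym (ℤ.+-identityˡ _))

  𝟙-unique-witness : {P : Set} (P? : Dec P) {Q : A → Set} (Q? : ∀ a → Dec (Q a)) (xs : List A) → Unique xs →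
    (P → ∃ λ a → a ∈ xs × Q a) → (∀ {a} → a ∈ xs → Q a → P) → (∀ {a b} → a ∈ xs → b ∈ xs → Q a → Q b → a ≡ b) →
    𝟙 P? ≡ sumOver xs (𝟙 ∘ Q?)
  𝟙-unique-witness P? Q? [] _ witness _ _ with P?
  ... | yes p = case (proj₁ (proj₂ (witness p)))
    where
    case : ∀ {a} → a ∈ [] → _
    case ()
  ... | no _ = refl
  𝟙-unique-witness {P = P} P? {Q} Q? (x ∷ xs) (x∉xs ∷ unique) witness sound one with Q? x
  ... | yes qx = trans (𝟙-yes P? (sound (here refl) qx)) (sym (cong (_+_ 1ℤ) others))
    where
    others : sumOver xs (𝟙 ∘ Q?) ≡ 0ℤ
    others = sumOver-zero (All.tabulate λ {y} y∈xs → 𝟙-no (Q? y) λ qy → All.lookup x∉xs y∈xs (one (here refl) (there y∈xs) qx qy))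
  ... | no ¬qx = trans (𝟙-unique-witness P? Q? xs unique witness′ (sound ∘ there) (λ a∈ b∈ → one (there a∈) (there b∈)))
    (sym (ℤ.+-identityˡ _))
    where
    witness′ : P → ∃ λ a → a ∈ xs × Q a
    witness′ p with witness p
    ... | a , here refl , qa = ⊥-elim (¬qx qa)
    ... | a , there a∈xs , qa = a , a∈xs , qa

  allWords-length : ∀ L → All (λ w → length w ≡ L) (allWords L)
  allWords-length zero    = refl ∷ []
  allWords-length (suc L) = go (allWords L) (allWords-length L)
    where
    go : ∀ ws → All (λ w → length w ≡ L) ws → All (λ w → length w ≡ suc L) (concatMap (λ w → (u ∷ w) ∷ (r ∷ w) ∷ []) ws)
    go []       []         = []
    go (w ∷ ws) (eq ∷ eqs) = cong suc eq ∷ cong suc eq ∷ go ws eqs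

  sumOver-allWords-cong : ∀ L {h h′ : Word → ℤ} → (∀ w → length w ≡ L → h w ≡ h′ w) → sumOver (allWords L) h ≡ sumOver (allWords L) h′
  sumOver-allWords-cong L h≗h′ = sumOver-cong-All (All.map (λ {w} → h≗h′ w) (allWords-length L))

  sumOver-allWords-suc : ∀ L h → sumOver (allWords (suc L)) h ≡ sumOver (allWords L) λ w → h (u ∷ w) + h (r ∷ w)
  sumOver-allWords-suc L h = trans (sumOver-concatMap (allWords L) (λ w → (u ∷ w) ∷ (r ∷ w) ∷ []) h)
    (sumOver-cong (allWords L) λ w → cong (_+_ (h (u ∷ w))) (ℤ.+-identityʳ (h (r ∷ w))))

  sumOver-allWords-+ : ∀ L M h → sumOver (allWords (L ℕ.+ M)) h ≡ sumOver (allWords L) λ v → sumOver (allWords M) λ q → h (v ++ q)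
  sumOver-allWords-+ zero    M h = sym (ℤ.+-identityʳ _)
  sumOver-allWords-+ (suc L) M h = begin
    sumOver (allWords (suc (L ℕ.+ M))) h
      ≡⟨ sumOver-allWords-suc (L ℕ.+ M) h ⟩
    sumOver (allWords (L ℕ.+ M)) (λ w → h (u ∷ w) + h (r ∷ w))
      ≡⟨ sumOver-allWords-+ L M _ ⟩
    sumOver (allWords L) (λ v → sumOver (allWords M) λ q → h (u ∷ v ++ q) + h (r ∷ v ++ q))
      ≡⟨ sumOver-cong (allWords L) (λ v → sumOver-+ (allWords M) _ _) ⟩
    sumOver (allWords L) (λ v → sumOver (allWords M) (λ q → h (u ∷ v ++ q)) + sumOver (allWords M) (λ q → h (r ∷ v ++ q)))
      ≡⟨ sumOver-allWords-suc L (λ v → sumOver (allWords M) λ q → h (v ++ q)) ⟨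
    sumOver (allWords (suc L)) (λ v → sumOver (allWords M) λ q → h (v ++ q)) ∎
    where open ≡-Reasoning

  sumOver-allWords-single : ∀ g h → (∀ q → length q ≡ length g → q ≢ g → h q ≡ 0ℤ) → sumOver (allWords (length g)) h ≡ h g
  sumOver-allWords-single []      h _     = ℤ.+-identityʳ (h [])
  sumOver-allWords-single (s ∷ g) h zeros = trans (sumOver-allWords-suc (length g) h) (trans
    (sumOver-allWords-cong (length g) λ w |w| → keep s zeros w |w|)
    (sumOver-allWords-single g (h ∘ (s ∷_)) λ q |q| q≢g → zeros (s ∷ q) (cong suc |q|) (q≢g ∘ List.∷-injectiveʳ)))
    where
    keep : ∀ s → (∀ q → length q ≡ suc (length g) → q ≢ s ∷ g → h q ≡ 0ℤ) →
      ∀ w → length w ≡ length g → h (u ∷ w) + h (r ∷ w) ≡ h (s ∷ w)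
    keep u zeros w |w| = trans (cong (_+_ (h (u ∷ w))) (zeros (r ∷ w) (cong suc |w|) λ ())) (ℤ.+-identityʳ (h (u ∷ w)))
    keep r zeros w |w| = trans (cong (_+ h (r ∷ w)) (zeros (u ∷ w) (cong suc |w|) λ ())) (ℤ.+-identityˡ (h (r ∷ w)))

  endpoint? : ∀ n x w → Dec (#r w ≡ n × #u w ≡ x)
  endpoint? n x w = (#r w ≟ n) ×-dec (#u w ≟ x)

  pathSum : ℤ → ℤ → (Word → ℤ) → ℤ
  pathSum (+ n)    (+ x)    h = sumOver (allWords (n ℕ.+ x)) λ w → 𝟙 (endpoint? n x w) * h w
  pathSum (+ _)    -[1+ _ ] _ = 0ℤ
  pathSum -[1+ _ ] _        _ = 0ℤ

  +m-+n≡+[m∸n] : ∀ {m n} → n ≤ m → + m - + n ≡ + (m ∸ n)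
  +m-+n≡+[m∸n] {m} {n} n≤m = trans (ℤ.m-n≡m⊖n m n) (ℤ.⊖-≥ n≤m)

  +m-+n≡-[1+n∸[1+m]] : ∀ {m n} → m < n → + m - + n ≡ -[1+ (n ∸ suc m) ]
  +m-+n≡-[1+n∸[1+m]] {m} {n} m<n = trans (ℤ.m-n≡m⊖n m n) (trans (ℤ.⊖-< m<n) (cong (λ k → ℤ.- (+ k)) (ℕ.+-∸-assoc 1 m<n)))

  a+b≡c⇒a≡c-b : ∀ a b c → a + b ≡ c → a ≡ c - b
  a+b≡c⇒a≡c-b a b c a+b≡c = trans (sym (cancel a b)) (cong (_- b) a+b≡c)
    where
    cancel : ∀ a b → a + b - b ≡ a
    cancel = solve-∀

  pathSum-cong : ∀ n x {h h′ : Word → ℤ} → (∀ w → #r w ≡ n → #u w ≡ x → h w ≡ h′ w) →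
    pathSum (+ n) (+ x) h ≡ pathSum (+ n) (+ x) h′
  pathSum-cong n x {h} {h′} h≗h′ = sumOver-cong (allWords (n ℕ.+ x)) λ w → at w (endpoint? n x w)
    where
    at : ∀ w (e : Dec (#r w ≡ n × #u w ≡ x)) → 𝟙 e * h w ≡ 𝟙 e * h′ w
    at w (yes (#r≡n , #u≡x)) = cong (1ℤ *_) (h≗h′ w #r≡n #u≡x)
    at w (no _)              = refl

  pathSum-zero : ∀ n x {h : Word → ℤ} → (∀ w → #r w ≡ n → #u w ≡ x → h w ≡ 0ℤ) → pathSum (+ n) (+ x) h ≡ 0ℤ
  pathSum-zero n x h≗0 = trans (pathSum-cong n x h≗0)
    (sumOver-zero (All.universal (λ w → ℤ.*-zeroʳ (𝟙 (endpoint? n x w))) (allWords (n ℕ.+ x))))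

  pathSum-+ : ∀ N X (h h′ : Word → ℤ) → pathSum N X (λ w → h w + h′ w) ≡ pathSum N X h + pathSum N X h′
  pathSum-+ (+ n)    (+ x)    h h′ = trans (sumOver-cong (allWords (n ℕ.+ x)) λ w → ℤ.*-distribˡ-+ (𝟙 (endpoint? n x w)) (h w) (h′ w))
    (sumOver-+ (allWords (n ℕ.+ x)) _ _)
  pathSum-+ (+ _)    -[1+ _ ] h h′ = refl
  pathSum-+ -[1+ _ ] _        h h′ = refl

  pathSum-sumOver : ∀ N X (xs : List A) (h : A → Word → ℤ) →
    pathSum N X (λ w → sumOver xs λ a → h a w) ≡ sumOver xs λ a → pathSum N X (h a)
  pathSum-sumOver (+ n)    (+ x)    xs h = trans (sumOver-cong (allWords (n ℕ.+ x)) λ w → sym (sumOver-*ˡ xs (𝟙 (endpoint? n x w)) _))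
    (sumOver-swap (allWords (n ℕ.+ x)) xs _)
  pathSum-sumOver (+ _)    -[1+ _ ] xs h = sym (sumOver-zero (All.universal (λ _ → refl) xs))
  pathSum-sumOver -[1+ _ ] _        xs h = sym (sumOver-zero (All.universal (λ _ → refl) xs))

  pathSum-∷ʳ : ∀ n x h → pathSum (+ suc n) (+ suc x) h ≡
    pathSum (+ suc n) (+ x) (λ v → h (v ++ [ u ])) + pathSum (+ n) (+ suc x) (λ v → h (v ++ [ r ]))
  pathSum-∷ʳ n x h = begin
    sumOver (allWords (suc n ℕ.+ suc x)) F
      ≡⟨ cong (λ L → sumOver (allWords L) F) (ℕ.+-comm 1 (n ℕ.+ suc x)) ⟩
    sumOver (allWords (n ℕ.+ suc x ℕ.+ 1)) F
      ≡⟨ sumOver-allWords-+ (n ℕ.+ suc x) 1 F ⟩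
    sumOver (allWords (n ℕ.+ suc x)) (λ v → F (v ++ [ u ]) + (F (v ++ [ r ]) + 0ℤ))
      ≡⟨ sumOver-cong (allWords (n ℕ.+ suc x)) (λ v → cong₂ _+_ (last-u v) (trans (ℤ.+-identityʳ _) (last-r v))) ⟩
    sumOver (allWords (n ℕ.+ suc x)) (λ v → Fu v + Fr v)
      ≡⟨ sumOver-+ (allWords (n ℕ.+ suc x)) Fu Fr ⟩
    sumOver (allWords (n ℕ.+ suc x)) Fu + sumOver (allWords (n ℕ.+ suc x)) Fr
      ≡⟨ cong (λ L → sumOver (allWords L) Fu + sumOver (allWords (n ℕ.+ suc x)) Fr) (ℕ.+-suc n x) ⟩
    sumOver (allWords (suc n ℕ.+ x)) Fu + sumOver (allWords (n ℕ.+ suc x)) Fr ∎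
    where
    open ≡-Reasoning
    F Fu Fr : Word → ℤ
    F w  = 𝟙 (endpoint? (suc n) (suc x) w) * h w
    Fu v = 𝟙 (endpoint? (suc n) x v) * h (v ++ [ u ])
    Fr v = 𝟙 (endpoint? n (suc x) v) * h (v ++ [ r ])
    #r-∷ʳu : ∀ v → #r (v ++ [ u ]) ≡ #r v
    #r-∷ʳu v = trans (#r-++ v [ u ]) (ℕ.+-identityʳ (#r v))
    #u-∷ʳu : ∀ v → #u (v ++ [ u ]) ≡ suc (#u v)
    #u-∷ʳu v = trans (#u-++ v [ u ]) (ℕ.+-comm (#u v) 1)
    #r-∷ʳr : ∀ v → #r (v ++ [ r ]) ≡ suc (#r v)
    #r-∷ʳr v = trans (#r-++ v [ r ]) (ℕ.+-comm (#r v) 1)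
    #u-∷ʳr : ∀ v → #u (v ++ [ r ]) ≡ #u v
    #u-∷ʳr v = trans (#u-++ v [ r ]) (ℕ.+-identityʳ (#u v))
    last-u : ∀ v → F (v ++ [ u ]) ≡ Fu v
    last-u v = cong (_* h (v ++ [ u ])) (𝟙-⇔ (endpoint? (suc n) (suc x) (v ++ [ u ])) (endpoint? (suc n) x v) (mk⇔
      (λ (#r≡ , #u≡) → trans (sym (#r-∷ʳu v)) #r≡ , ℕ.suc-injective (trans (sym (#u-∷ʳu v)) #u≡))
      (λ (#r≡ , #u≡) → trans (#r-∷ʳu v) #r≡ , trans (#u-∷ʳu v) (cong suc #u≡))))
    last-r : ∀ v → F (v ++ [ r ]) ≡ Fr v
    last-r v = cong (_* h (v ++ [ r ])) (𝟙-⇔ (endpoint? (suc n) (suc x) (v ++ [ r ])) (endpoint? n (suc x) v) (mk⇔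
      (λ (#r≡ , #u≡) → ℕ.suc-injective (trans (sym (#r-∷ʳr v)) #r≡) , trans (sym (#u-∷ʳr v)) #u≡)
      (λ (#r≡ , #u≡) → trans (#r-∷ʳr v) (cong suc #r≡) , trans (#u-∷ʳr v) #u≡)))

  pathSum-suffixed : ∀ n x g {P : Word → Set} (P? : ∀ t → Dec (P t)) →
    pathSum (+ n) (+ x) (𝟙 ∘ suffixed? g P?) ≡ pathSum (+ n - + #r g) (+ x - + #u g) (𝟙 ∘ P?)
  pathSum-suffixed n x g P? with #r g ℕ.≤? n | #u g ℕ.≤? x
  ... | no b≰n | _ rewrite +m-+n≡-[1+n∸[1+m]] (ℕ.≰⇒> b≰n) =
    pathSum-zero n x λ w #r≡n _ → 𝟙-no (suffixed? g P? w) λ (t , w≡tg , _) →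
      b≰n (subst (#r g ≤_) (trans (sym (#r-++ t g)) (trans (cong #r (sym w≡tg)) #r≡n)) (ℕ.m≤n+m (#r g) (#r t)))
  ... | yes b≤n | no d≰x rewrite +m-+n≡+[m∸n] b≤n | +m-+n≡-[1+n∸[1+m]] (ℕ.≰⇒> d≰x) =
    pathSum-zero n x λ w _ #u≡x → 𝟙-no (suffixed? g P? w) λ (t , w≡tg , _) →
      d≰x (subst (#u g ≤_) (trans (sym (#u-++ t g)) (trans (cong #u (sym w≡tg)) #u≡x)) (ℕ.m≤n+m (#u g) (#u t)))
  ... | yes b≤n | yes d≤x rewrite +m-+n≡+[m∸n] b≤n | +m-+n≡+[m∸n] d≤x = begin
    sumOver (allWords (n ℕ.+ x)) F
      ≡⟨ cong (λ L → sumOver (allWords L) F) length-split ⟨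
    sumOver (allWords (n′ ℕ.+ x′ ℕ.+ length g)) F
      ≡⟨ sumOver-allWords-+ (n′ ℕ.+ x′) (length g) F ⟩
    sumOver (allWords (n′ ℕ.+ x′)) (λ t → sumOver (allWords (length g)) λ q → F (t ++ q))
      ≡⟨ sumOver-cong (allWords (n′ ℕ.+ x′)) (λ t → sumOver-allWords-single g (λ q → F (t ++ q)) (off-g t)) ⟩
    sumOver (allWords (n′ ℕ.+ x′)) (λ t → F (t ++ g))
      ≡⟨ sumOver-cong (allWords (n′ ℕ.+ x′)) at-g ⟩
    sumOver (allWords (n′ ℕ.+ x′)) (λ t → 𝟙 (endpoint? n′ x′ t) * 𝟙 (P? t)) ∎
    where
    open ≡-Reasoning
    n′ = n ∸ #r g
    x′ = x ∸ #u g
    F : Word → ℤ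
    F w = 𝟙 (endpoint? n x w) * 𝟙 (suffixed? g P? w)
    length-split : n′ ℕ.+ x′ ℕ.+ length g ≡ n ℕ.+ x
    length-split = begin
      n′ ℕ.+ x′ ℕ.+ length g          ≡⟨ cong (n′ ℕ.+ x′ ℕ.+_) (length≡#r+#u g) ⟩
      n′ ℕ.+ x′ ℕ.+ (#r g ℕ.+ #u g)   ≡⟨ interchange n′ x′ (#r g) (#u g) ⟩
      (n′ ℕ.+ #r g) ℕ.+ (x′ ℕ.+ #u g) ≡⟨ cong₂ ℕ._+_ (ℕ.m∸n+n≡m b≤n) (ℕ.m∸n+n≡m d≤x) ⟩
      n ℕ.+ x                          ∎
      where
      interchange : ∀ a b c d → a ℕ.+ b ℕ.+ (c ℕ.+ d) ≡ (a ℕ.+ c) ℕ.+ (b ℕ.+ d)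
      interchange = ℕ-solve-∀
    off-g : ∀ t q → length q ≡ length g → q ≢ g → F (t ++ q) ≡ 0ℤ
    off-g t q |q| q≢g = trans (cong (𝟙 (endpoint? n x (t ++ q)) *_)
      (𝟙-no (suffixed? g P? (t ++ q)) λ (t′ , eq , _) → q≢g (++-≡-++-length t q t′ g eq |q|))) (ℤ.*-zeroʳ (𝟙 (endpoint? n x (t ++ q))))
    at-g : ∀ t → F (t ++ g) ≡ 𝟙 (endpoint? n′ x′ t) * 𝟙 (P? t)
    at-g t = cong₂ _*_ (𝟙-⇔ (endpoint? n x (t ++ g)) (endpoint? n′ x′ t) (mk⇔
      (λ (#r≡n , #u≡x) → sym (trans (cong (_∸ #r g) (trans (sym #r≡n) (#r-++ t g))) (ℕ.m+n∸n≡m (#r t) (#r g))) ,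
                         sym (trans (cong (_∸ #u g) (trans (sym #u≡x) (#u-++ t g))) (ℕ.m+n∸n≡m (#u t) (#u g))))
      (λ (#r≡n′ , #u≡x′) → trans (#r-++ t g) (trans (cong (ℕ._+ #r g) #r≡n′) (ℕ.m∸n+n≡m b≤n)) ,
                           trans (#u-++ t g) (trans (cong (ℕ._+ #u g) #u≡x′) (ℕ.m∸n+n≡m d≤x)))))
      (𝟙-⇔ (suffixed? g P? (t ++ g)) (P? t) Suffixed-++)

  𝟙-× : (a? : Dec A) (b? : Dec B) → 𝟙 (a? ×-dec b?) ≡ 𝟙 a? * 𝟙 b?
  𝟙-× (yes _) (yes _) = refl
  𝟙-× (yes _) (no _)  = refl
  𝟙-× (no _)  _       = refl

module FirstOccurrences where

  open import Defs
  open Sums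
  open AlternatingSums
  open Paths
  open PathSums
  open import Function using (_∘_)
  open import Function.Bundles using (_⇔_; Equivalence)
  open import Data.Nat as ℕ using (ℕ; suc; _∸_; _≤_; _<_; s≤s)
  import Data.Nat.Properties as ℕ
  open import Data.Nat.Induction using (<-rec)
  open import Data.Integer as ℤ using (ℤ; +_; -[1+_]; _+_; _*_; _-_; 0ℤ; 1ℤ; -1ℤ; _^_; -<+)
  import Data.Integer.Properties as ℤ
  open import Data.Integer.Tactic.RingSolver using (solve-∀)
  open import Data.List using (List; _++_; [_]; upTo)
  open import Data.List.Relation.Unary.All as All using (All)
  open import Data.List.Relation.Unary.Unique.Propositional using (Unique)
  open import Data.List.Membership.Propositional using (_∈_)
  open import Data.List.Relation.Binary.Infix.Heterogeneous.Properties using (infix?)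
  open import Data.Product using (∃; _×_; _,_; proj₂)
  open import Relation.Nullary using (Dec; yes; no; ¬_; ¬?)
  open import Relation.Nullary.Decidable using (_×-dec_)
  open import Relation.Binary.PropositionalEquality hiding ([_])

  module _ (p₀ : Word) (p-rightHeavy : RightHeavySuffixes (p₀ ++ [ r ])) where

    open Pattern p₀

    good? : ∀ w → Dec (Good w)
    good? w = ballot? w ×-dec avoids? w p

    goodPrefix? : ∀ t → Dec (GoodPrefix t)
    goodPrefix? t = ballot? t ×-dec avoids? (t ++ p₀) p

    firstOccurrences : ℤ → ℤ → ℤ
    firstOccurrences N X = pathSum N X (𝟙 ∘ goodPrefix?)

    s≡pathSum : ∀ N X → s p N X ≡ pathSum N X (𝟙 ∘ good?)
    s≡pathSum (+ n)    (+ x)    = trans (length-filter _ (allWords (n ℕ.+ x)))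
      (sumOver-cong (allWords (n ℕ.+ x)) λ w → 𝟙-× (endpoint? n x w) (good? w))
    s≡pathSum (+ _)    -[1+ _ ] = refl
    s≡pathSum -[1+ _ ] _        = refl

    s-last-step : ∀ n x → n ≤ x → s p (+ suc n) (+ suc x) ≡
      s p (+ n) (+ suc x) + s p (+ suc n) (+ x) - firstOccurrences (+ suc n - + #r p) (+ suc x - + #u p)
    s-last-step n x n≤x = begin
      s p (+ suc n) (+ suc x)
        ≡⟨ trans (s≡pathSum (+ suc n) (+ suc x)) (pathSum-∷ʳ n x G) ⟩
      pathSum (+ suc n) (+ x) (λ v → G (v ++ [ u ])) + pathSum (+ n) (+ suc x) (λ v → G (v ++ [ r ]))
        ≡⟨ cong₂ _+_ (pathSum-cong (suc n) x λ v _ _ → 𝟙-⇔ (good? (v ++ [ u ])) (good? v) (Good-∷ʳu v)) (drop-r) ⟩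
      pathSum (+ suc n) (+ x) G + (pathSum (+ n) (+ suc x) G - pathSum (+ n) (+ suc x) S)
        ≡⟨ cong₂ (λ a b → a + (b - pathSum (+ n) (+ suc x) S)) (sym (s≡pathSum (+ suc n) (+ x))) (sym (s≡pathSum (+ n) (+ suc x))) ⟩
      s p (+ suc n) (+ x) + (s p (+ n) (+ suc x) - pathSum (+ n) (+ suc x) S)
        ≡⟨ rearrange (s p (+ suc n) (+ x)) (s p (+ n) (+ suc x)) (pathSum (+ n) (+ suc x) S) ⟩
      s p (+ n) (+ suc x) + s p (+ suc n) (+ x) - pathSum (+ n) (+ suc x) S
        ≡⟨ cong (s p (+ n) (+ suc x) + s p (+ suc n) (+ x) -_) S-count ⟩
      s p (+ n) (+ suc x) + s p (+ suc n) (+ x) - firstOccurrences (+ suc n - + #r p) (+ suc x - + #u p) ∎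
      where
      open ≡-Reasoning
      G S : Word → ℤ
      G = 𝟙 ∘ good?
      S = 𝟙 ∘ suffixed? p₀ goodPrefix?
      rearrange : ∀ a b c → a + (b - c) ≡ b + a - c
      rearrange = solve-∀
      last-r : ∀ v → #r v ≡ n → #u v ≡ suc x → G (v ++ [ r ]) + S v ≡ G v
      last-r v refl #u≡1+x = trans (cong₂ _+_
        (𝟙-⇔ (good? (v ++ [ r ])) (good? v ×-dec ¬? (endsWith? p₀ v)) (Good-∷ʳr v v-above))
        (𝟙-⇔ (suffixed? p₀ goodPrefix? v) (good? v ×-dec endsWith? p₀ v) (Suffixed-p₀⇔ p-rightHeavy v v-above)))
        (𝟙-split (good? v) (endsWith? p₀ v))
        where
        v-above : #r v < #u v
        v-above = subst (#r v <_) (sym #u≡1+x) (s≤s n≤x)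
      drop-r : pathSum (+ n) (+ suc x) (λ v → G (v ++ [ r ])) ≡ pathSum (+ n) (+ suc x) G - pathSum (+ n) (+ suc x) S
      drop-r = a+b≡c⇒a≡c-b _ _ _ (trans (sym (pathSum-+ (+ n) (+ suc x) (λ v → G (v ++ [ r ])) S)) (pathSum-cong n (suc x) last-r))
      S-count : pathSum (+ n) (+ suc x) S ≡ firstOccurrences (+ suc n - + #r p) (+ suc x - + #u p)
      S-count = trans (pathSum-suffixed n (suc x) p₀ goodPrefix?) (cong₂ firstOccurrences
        (sym (trans (cong (+ suc n -_) (trans (cong +_ (#r-++ p₀ [ r ])) (ℤ.pos-+ (#r p₀) 1))) (drop-one (+ n) (+ #r p₀))))
        (cong (λ k → + suc x - + k) (sym (trans (#u-++ p₀ [ r ]) (ℕ.+-identityʳ (#u p₀))))))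
        where
        drop-one : ∀ a b → 1ℤ + a - (b + 1ℤ) ≡ a - b
        drop-one = solve-∀

    module _ (os : List Word) (unique : Unique os) (bifixes : ∀ o → o ∈ os ⇔ IsBifix o p) where

      s-decomposition : ∀ m y → m ℕ.+ #r p ≤ y ℕ.+ #u p →
        s p (+ m) (+ y) ≡ firstOccurrences (+ m) (+ y) + sumOver os λ o → firstOccurrences (+ m - + bdim p o) (+ y - + ddim p o)
      s-decomposition m y endpoint = begin
        s p (+ m) (+ y)
          ≡⟨ s≡pathSum (+ m) (+ y) ⟩
        pathSum (+ m) (+ y) (𝟙 ∘ good?)
          ≡⟨ pathSum-cong m y split ⟩
        pathSum (+ m) (+ y) (λ v → 𝟙 (goodPrefix? v) + sumOver os λ o → S o v)
          ≡⟨ pathSum-+ (+ m) (+ y) (𝟙 ∘ goodPrefix?) _ ⟩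
        firstOccurrences (+ m) (+ y) + pathSum (+ m) (+ y) (λ v → sumOver os λ o → S o v)
          ≡⟨ cong (_+_ (firstOccurrences (+ m) (+ y))) (trans (pathSum-sumOver (+ m) (+ y) os S)
               (sumOver-cong os λ o → pathSum-suffixed m y (front p o) goodPrefix?)) ⟩
        firstOccurrences (+ m) (+ y) + sumOver os (λ o → firstOccurrences (+ m - + bdim p o) (+ y - + ddim p o)) ∎
        where
        open ≡-Reasoning
        S : Word → Word → ℤ
        S o = 𝟙 ∘ suffixed? (front p o) goodPrefix?
        occurs? : ∀ w → Dec (Occurs p w)
        occurs? = infix? _≟ˢ_ p
        split : ∀ v → #r v ≡ m → #u v ≡ y → 𝟙 (good? v) ≡ 𝟙 (goodPrefix? v) + sumOver os λ o → S o v
        split v #r≡m #u≡y = begin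
          𝟙 (good? v)
            ≡⟨ 𝟙-split (good? v) (occurs? (v ++ p₀)) ⟨
          𝟙 (good? v ×-dec ¬? (occurs? (v ++ p₀))) + 𝟙 (good? v ×-dec occurs? (v ++ p₀))
            ≡⟨ cong₂ _+_ (sym (𝟙-⇔ (goodPrefix? v) (good? v ×-dec ¬? (occurs? (v ++ p₀))) (GoodPrefix⇔ v)))
                 (𝟙-unique-witness (good? v ×-dec occurs? (v ++ p₀)) (λ o → suffixed? (front p o) goodPrefix? v) os unique
                   witness (λ o∈ suffixed → Suffixed-bifix⇒Good p-rightHeavy (bifix o∈) suffixed vp-endpoint)
                   (λ o∈ o′∈ → Suffixed-bifix-unique (bifix o∈) (bifix o′∈))) ⟩
          𝟙 (goodPrefix? v) + sumOver os (λ o → S o v) ∎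
          where
          bifix : ∀ {o} → o ∈ os → IsBifix o p
          bifix {o} = Equivalence.to (bifixes o)
          witness : Good v × Occurs p (v ++ p₀) → ∃ λ o → o ∈ os × Suffixed (front p o) GoodPrefix v
          witness (good , oc) with o , o-bifix , suffixed ← Good⇒Suffixed-bifix v good oc =
            o , Equivalence.from (bifixes o) o-bifix , suffixed
          vp-endpoint : #r (v ++ p) ≤ #u (v ++ p)
          vp-endpoint = subst₂ _≤_ (sym (trans (#r-++ v p) (cong (ℕ._+ #r p) #r≡m)))
                                   (sym (trans (#u-++ v p) (cong (ℕ._+ #u p) #u≡y))) endpoint

      open MultinomialShifts (bdim p) (ddim p)

      1≤bdim : All (λ o → 1 ≤ bdim p o) os
      1≤bdim = All.tabulate λ {o} o∈ → proj₂ (bifix-dims p-rightHeavy (Equivalence.to (bifixes o) o∈))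

      alternatingSum-negative : ∀ K M X → alternatingSum os K (s p) -[1+ M ] X ≡ 0ℤ
      alternatingSum-negative K M X = sumOver-zero (All.universal (λ k → trans
        (cong (-1ℤ ^ k *_) (multiSum-vanishes os 1≤bdim k (s p) (λ _ _ → refl) -[1+ M ] X -<+)) (ℤ.*-zeroʳ (-1ℤ ^ k))) (upTo (suc K)))

      alternatingSum-s-recurrence : ∀ K m y → m ≤ K → alternatingSum os K (s p) (+ m) (+ y) ≡
        s p (+ m) (+ y) - sumOver os λ o → alternatingSum os K (s p) (+ m - + bdim p o) (+ y - + ddim p o)
      alternatingSum-s-recurrence K m y m≤K = trans
        (sym (alternatingSum-suc os K (s p) (+ m) (+ y) (multiSum-vanishes os 1≤bdim (suc K) (s p) (λ _ _ → refl) (+ m) (+ y) (ℤ.+<+ (s≤s m≤K)))))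
        (a+b≡c⇒a≡c-b _ _ _ (alternatingSum-recurrence os K (s p) (+ m) (+ y)))

      private
        c≤a : #u p ≤ #r p
        c≤a = RightHeavySuffixes⇒#u≤#r p p-rightHeavy

        shift-invariant : ∀ {m y b d} → d ≤ b → b ≤ m → m ℕ.+ #r p ≤ y ℕ.+ #u p → d ≤ y × m ∸ b ℕ.+ #r p ≤ y ∸ d ℕ.+ #u p
        shift-invariant {m} {y} {b} {d} d≤b b≤m inv = d≤y , ℕ.+-cancelʳ-≤ b _ _ (begin
          m ∸ b ℕ.+ a ℕ.+ b          ≡⟨ ℕ.+-assoc (m ∸ b) a b ⟩
          m ∸ b ℕ.+ (a ℕ.+ b)        ≡⟨ cong (m ∸ b ℕ.+_) (ℕ.+-comm a b) ⟩
          m ∸ b ℕ.+ (b ℕ.+ a)        ≡⟨ ℕ.+-assoc (m ∸ b) b a ⟨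
          m ∸ b ℕ.+ b ℕ.+ a          ≡⟨ cong (ℕ._+ a) (ℕ.m∸n+n≡m b≤m) ⟩
          m ℕ.+ a                    ≤⟨ inv ⟩
          y ℕ.+ c                    ≡⟨ cong (ℕ._+ c) (ℕ.m∸n+n≡m d≤y) ⟨
          y ∸ d ℕ.+ d ℕ.+ c          ≤⟨ ℕ.+-monoˡ-≤ c (ℕ.+-monoʳ-≤ (y ∸ d) d≤b) ⟩
          y ∸ d ℕ.+ b ℕ.+ c          ≡⟨ ℕ.+-assoc (y ∸ d) b c ⟩
          y ∸ d ℕ.+ (b ℕ.+ c)        ≡⟨ cong (y ∸ d ℕ.+_) (ℕ.+-comm b c) ⟩
          y ∸ d ℕ.+ (c ℕ.+ b)        ≡⟨ ℕ.+-assoc (y ∸ d) c b ⟨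
          y ∸ d ℕ.+ c ℕ.+ b          ∎)
          where
          open ℕ.≤-Reasoning
          a = #r p
          c = #u p
          m≤y : m ≤ y
          m≤y = ℕ.+-cancelʳ-≤ a m y (ℕ.≤-trans inv (ℕ.+-monoʳ-≤ y c≤a))
          d≤y : d ≤ y
          d≤y = ℕ.≤-trans d≤b (ℕ.≤-trans b≤m m≤y)

      firstOccurrences≡alternatingSum : ∀ m y → m ℕ.+ #r p ≤ y ℕ.+ #u p → ∀ K → m ≤ K →
        firstOccurrences (+ m) (+ y) ≡ alternatingSum os K (s p) (+ m) (+ y)
      firstOccurrences≡alternatingSum = <-rec _ λ m rec y inv K m≤K → begin
        firstOccurrences (+ m) (+ y)
          ≡⟨ a+b≡c⇒a≡c-b _ _ _ (sym (s-decomposition m y inv)) ⟩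
        s p (+ m) (+ y) - sumOver os (λ o → firstOccurrences (+ m - + bdim p o) (+ y - + ddim p o))
          ≡⟨ cong (s p (+ m) (+ y) -_) (sumOver-cong-All (All.tabulate λ {o} o∈ → shifted m rec y inv K m≤K (Equivalence.to (bifixes o) o∈))) ⟩
        s p (+ m) (+ y) - sumOver os (λ o → alternatingSum os K (s p) (+ m - + bdim p o) (+ y - + ddim p o))
          ≡⟨ alternatingSum-s-recurrence K m y m≤K ⟨
        alternatingSum os K (s p) (+ m) (+ y) ∎
        where
        open ≡-Reasoning
        shifted : ∀ m → (∀ {m′} → m′ < m → ∀ y → m′ ℕ.+ #r p ≤ y ℕ.+ #u p → ∀ K → m′ ≤ K →
                     firstOccurrences (+ m′) (+ y) ≡ alternatingSum os K (s p) (+ m′) (+ y)) →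
          ∀ y → m ℕ.+ #r p ≤ y ℕ.+ #u p → ∀ K → m ≤ K → ∀ {o} → IsBifix o p →
          firstOccurrences (+ m - + bdim p o) (+ y - + ddim p o) ≡ alternatingSum os K (s p) (+ m - + bdim p o) (+ y - + ddim p o)
        shifted m rec y inv K m≤K {o} bifix with bdim p o ℕ.≤? m
        ... | no b≰m rewrite +m-+n≡-[1+n∸[1+m]] (ℕ.≰⇒> b≰m) = sym (alternatingSum-negative K _ (+ y - + ddim p o))
        ... | yes b≤m with d≤b , 1≤b ← bifix-dims p-rightHeavy bifix with d≤y , inv′ ← shift-invariant d≤b b≤m inv
            rewrite +m-+n≡+[m∸n] b≤m | +m-+n≡+[m∸n] d≤y =
          rec (ℕ.∸-monoʳ-< 1≤b b≤m) (y ∸ ddim p o) inv′ K (ℕ.≤-trans (ℕ.m∸n≤m m (bdim p o)) m≤K)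

      firstOccurrences≡alternatingSum-shifted : ∀ n x K → n ≤ x → n ≤ K →
        firstOccurrences (+ n - + #r p) (+ x - + #u p) ≡ alternatingSum os K (s p) (+ n - + #r p) (+ x - + #u p)
      firstOccurrences≡alternatingSum-shifted n x K n≤x n≤K with #r p ℕ.≤? n
      ... | no a≰n rewrite +m-+n≡-[1+n∸[1+m]] (ℕ.≰⇒> a≰n) = sym (alternatingSum-negative K _ (+ x - + #u p))
      ... | yes a≤n rewrite +m-+n≡+[m∸n] a≤n | +m-+n≡+[m∸n] (ℕ.≤-trans c≤a (ℕ.≤-trans a≤n n≤x)) =
        firstOccurrences≡alternatingSum (n ∸ #r p) (x ∸ #u p) inv K (ℕ.≤-trans (ℕ.m∸n≤m n (#r p)) n≤K)
        where
        c≤x : #u p ≤ x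
        c≤x = ℕ.≤-trans c≤a (ℕ.≤-trans a≤n n≤x)
        inv : n ∸ #r p ℕ.+ #r p ≤ x ∸ #u p ℕ.+ #u p
        inv = subst₂ _≤_ (sym (ℕ.m∸n+n≡m a≤n)) (sym (ℕ.m∸n+n≡m c≤x)) n≤x

      s-recurrence : ∀ n x K → 1 ≤ n → n ≤ x → n ≤ K →
        s p (+ n) (+ x) ≡ s p (+ n - + 1) (+ x) + s p (+ n) (+ x - + 1) - outerSum p os n x K
      s-recurrence (suc n) (suc x) K _ (s≤s n≤x) n≤K = trans (s-last-step n x n≤x)
        (cong (s p (+ n) (+ suc x) + s p (+ suc n) (+ x) -_) (firstOccurrences≡alternatingSum-shifted (suc n) (suc x) K (s≤s n≤x) n≤K))

open import Defs
open Paths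
open FirstOccurrences
open import Data.Nat using (ℕ; _≤_)
open import Data.Integer using (ℤ; +_; _+_; _-_)
open import Data.List using (List; [])
open import Data.List.Relation.Unary.Unique.Propositional using (Unique)
open import Data.List.Membership.Propositional using (_∈_)
open import Function.Bundles using (_⇔_)
open import Relation.Binary.PropositionalEquality using (_≡_; _≢_; refl)
open import Data.Product using (_,_)

mainTheorem3 : (p : Word) → p ≢ [] → DepthZero p →
    (os : List Word) → Unique os → (∀ o → (o ∈ os) ⇔ IsBifix o p) →
    (n x : ℕ) → 1 ≤ n → n ≤ x →
    (K : ℕ) → n ≤ K →
    s p (+ n) (+ x) ≡
      s p (+ n - + 1) (+ x) + s p (+ n) (+ x - + 1) - outerSum p os n x K
mainTheorem3 p p≢[] depthZero os unique bifixes n x 1≤n n≤x K n≤K with DepthZero-∷ʳ p p≢[] depthZero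
... | p₀ , refl = s-recurrence p₀ (DepthZero⇒RightHeavySuffixes p depthZero) os unique bifixes n x K 1≤n n≤x n≤K
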